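{- Let $G$ be a finite simple graph. For a finite simple graph $H$, let $\alpha(H)$ denote the absolute value of the coefficient of $q$ in the chromatic polynomial $\chi(H,q)$ of $H$, and let $e(H)$ denote the number of edges of $H$. Then $$2\,e(G)\,\alpha(G) \;=\; \sum_{(G_1,G_2)} \alpha(G_1)\,\alpha(G_2)\,e(G_1,G_2),$$ where the sum ranges over all ordered partitions $(G_1,G_2)$ of $G$, i.e. ordered pairs of non-empty induced subgraphs $G_1,G_2$ of $G$ whose vertex sets are disjoint with union $V(G)$, and $e(G_1,G_2)$ denotes the number of edges of $G$ having one endpoint in $G_1$ and the other endpoint in $G_2$.
   Context: $\alpha(G)$ is called the chromatic discriminant of $G$. An edge with one end in $G_1$ and the other in $G_2$ is said to straddle $G_1$ and $G_2$. -}

module Defs where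

open import Data.Nat using (ℕ; zero; suc; _+_; _*_; _<ᵇ_)
open import Data.Bool using (Bool; true; false; _∧_; _∨_; not; if_then_else_)
open import Data.Fin using (Fin; toℕ)
open import Data.Fin.Properties using () renaming (_≟_ to _≟ᶠ_)
open import Data.Product using (_×_; _,_; proj₁; proj₂)
open import Data.Maybe using (Maybe; just; nothing)
open import Data.List using (List; []; _∷_; map; concatMap; filter; length; allFin)
open import Data.Nat.ListAction using (sum)
open import Data.List.Relation.Unary.All using (All)
open import Data.Vec using (Vec; []; _∷_; lookup)
open import Data.Integer using (ℤ; +_; ∣_∣) renaming (_+_ to _+ℤ_; _*_ to _*ℤ_)
open import Data.Fin.Subset using (Subset; ∁; ⊤)
open import Relation.Nullary.Decidable using (⌊_⌋)
open import Relation.Binary.PropositionalEquality using (_≡_)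
open import Relation.Unary using (Pred)

record Graph : Set where
  field
    n     : ℕ
    adj   : Fin n → Fin n → Bool
    sym   : ∀ u v → adj u v ≡ adj v u
    irrefl : ∀ v → adj v v ≡ false

open Graph public

allVecs : {A : Set} → List A → (k : ℕ) → List (Vec A k)
allVecs xs zero    = [] ∷ []
allVecs xs (suc k) = concatMap (λ x → map (x ∷_) (allVecs xs k)) xs

countB : {A : Set} → (A → Bool) → List A → ℕ
countB p []       = 0
countB p (x ∷ xs) = (if p x then 1 else 0) + countB p xs

allB : {A : Set} → List A → (A → Bool) → Bool
allB []       p = true
allB (x ∷ xs) p = p x ∧ allB xs p

allSubsets : (k : ℕ) → List (Subset k)
allSubsets k = allVecs (false ∷ true ∷ []) k

eqMaybeFin : {q : ℕ} → Maybe (Fin q) → Maybe (Fin q) → Bool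
eqMaybeFin (just a) (just b) = ⌊ a ≟ᶠ b ⌋
eqMaybeFin nothing  nothing  = true
eqMaybeFin _        _        = false

isJust : {A : Set} → Maybe A → Bool
isJust (just _) = true
isJust nothing  = false

-- A proper q-colouring of the induced subgraph G[S] is encoded as a map
-- c : V(G) → Maybe (Fin q) with c v = nothing exactly for v ∉ S and with
-- c u ≠ c v for every edge uv of G[S].  (Bijective with proper colourings
-- V(G[S]) → Fin q.)
isProperColouring : (G : Graph) (S : Subset (n G)) {q : ℕ}
  → Vec (Maybe (Fin q)) (n G) → Bool
isProperColouring G S c =
  allB (allFin (n G)) (λ v →
    (if lookup S v then isJust (lookup c v) else not (isJust (lookup c v)))
    ∧ allB (allFin (n G)) (λ u →
        not (lookup S u ∧ lookup S v ∧ adj G u v)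
        ∨ not (eqMaybeFin (lookup c u) (lookup c v))))

numColourings : (G : Graph) → Subset (n G) → ℕ → ℕ
numColourings G S q =
  countB (isProperColouring G S) (allVecs (nothing ∷ map just (allFin q)) (n G))

-- integer polynomials as coefficient lists (constant term first)
Poly : Set
Poly = List ℤ

eval : Poly → ℤ → ℤ
eval []       x = + 0
eval (a ∷ as) x = a +ℤ x *ℤ eval as x

coeff : Poly → ℕ → ℤ
coeff []       _       = + 0
coeff (a ∷ as) zero    = a
coeff (a ∷ as) (suc k) = coeff as k

-- p is the chromatic polynomial of G[S]: it agrees with the number of
-- proper q-colourings for every q ∈ ℕ (which determines it uniquely).
IsChromaticPolynomial : (G : Graph) → Subset (n G) → Poly → Set
IsChromaticPolynomial G S p = ∀ (q : ℕ) → eval p (+ q) ≡ + numColourings G S q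

chromDisc : Poly → ℕ
chromDisc p = ∣ coeff p 1 ∣

numEdges : Graph → ℕ
numEdges G = countB (λ uv → (toℕ (proj₁ uv) <ᵇ toℕ (proj₂ uv))
                              ∧ adj G (proj₁ uv) (proj₂ uv))
                    (concatMap (λ u → map (u ,_) (allFin (n G))) (allFin (n G)))

numStraddling : (G : Graph) → Subset (n G) → ℕ
numStraddling G S =
  sum (map (λ u → countB (λ v → lookup S u ∧ not (lookup S v) ∧ adj G u v) (allFin (n G)))
           (allFin (n G)))

nonemptyB : {k : ℕ} → Subset k → Bool
nonemptyB {k} S = not (allB (allFin k) (λ v → not (lookup S v)))

partitionSum : (G : Graph) → (Subset (n G) → Poly) → ℕ
partitionSum G cp =
  sum (map (λ S → if nonemptyB S ∧ nonemptyB (∁ S)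
                  then chromDisc (cp S) * chromDisc (cp (∁ S)) * numStraddling G S
                  else 0)
           (allSubsets (n G)))

-- Write a(S) for the linear coefficient of χ(G[S]) and colour G[S] with x + y colours, x red and y blue.
-- For an edge uv of G[S], the proper colourings with u red and v blue are counted on the one hand by
-- splitting S into its red part U ∋ u and its blue part S ∖ U ∌ v, and on the other hand, since the
-- colours can be permuted freely, as x y Q(x + y), where χ(G[S], z) = z (z - 1) Q(z).  Comparing the
-- coefficients of x y gives  Σ_{u ∈ U ⊆ S ∖ {v}} a(U) a(S ∖ U) = -a(S).  Induction on |S| (if G[S] has no
-- edge, a vertex w is isolated and χ(G[S], z) = z χ(G[S ∖ {w}], z)) shows that a(S) has sign (-1)^(|S|-1),
-- so the same identity holds for α = |a|.  Summing it over the 2 e(G) ordered pairs of adjacent vertices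
-- (u, v) counts every ordered partition (U, ∁ U) exactly e(U, ∁ U) times.

module Submission where

open import Defs
open import Data.Nat using (ℕ; _*_)
open import Data.Fin.Subset using (Subset; ⊤)
open import Relation.Binary.PropositionalEquality using (_≡_)

open import Data.Nat using (zero; suc; _+_; _∸_; _≤_; _<_; s≤s; z≤n; _⊔_; _<ᵇ_)
import Data.Nat.Properties as ℕ
open import Data.Nat.Induction using (<-rec)
open import Data.Nat.ListAction using (sum)
open import Algebra.Properties.CommutativeSemigroup ℕ.+-commutativeSemigroup
  using () renaming (interchange to +-interchange)
open import Data.Integer as ℤ using (ℤ)
import Data.Integer.Properties as ℤₚ
open import Data.Bool using (Bool; true; false; _∧_; _∨_; not; if_then_else_)
import Data.Bool.Properties as Bool
open import Data.List using (List; []; _∷_; map; concatMap; length; _++_; tabulate; allFin)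
open import Data.List.Properties using (length-map; map-tabulate; length-tabulate)
open import Data.List.Membership.Propositional using (_∈_)
open import Data.List.Membership.Propositional.Properties using (∈-allFin)
open import Data.List.Relation.Unary.Any using (here; there)
open import Data.Product using (Σ-syntax; ∃-syntax; _×_; _,_; proj₁; proj₂; uncurry)
open import Data.Product.Properties using (,-injective)
open import Data.Sum using (inj₁; inj₂; [_,_]′)
open import Data.Vec using (Vec; []; _∷_; lookup; replicate; zipWith; _[_]≔_)
import Data.Vec as Vec
import Data.Vec.Properties as Vec
open import Data.Maybe using (Maybe; just; nothing)
import Data.Maybe as Maybe
import Data.Maybe.Properties as Maybe
open import Data.Fin using (Fin; zero; suc; toℕ; splitAt; join; _↑ˡ_; _↑ʳ_)
import Data.Fin.Properties as Fin
open import Data.Fin.Permutation using (Permutation′; _⟨$⟩ʳ_; _⟨$⟩ˡ_; inverseˡ; flip; transpose)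
open import Data.Fin.Subset using (∁; _─_; ⁅_⁆; ∣_∣)
import Data.Fin.Subset.Properties as Subset
open import Function using (_∘_; id; const)
open import Function.Bundles using (Equivalence; Injection; mk⇔)
open import Function.Properties.Inverse using (↔⇒↣)
open import Relation.Binary.Definitions using (DecidableEquality; tri<; tri≈; tri>)
open import Relation.Nullary using (Dec; yes; no; does; map′; _×-dec_; contradiction; ¬_)
open import Relation.Nullary.Decidable using (dec-true; dec-false; does-⇔; isYes≗does)
open import Relation.Binary.PropositionalEquality as ≡
  using (_≢_; refl; trans; cong; cong₂; subst; subst₂; module ≡-Reasoning)
open ≡-Reasoning

-- Finite sums

∑ : {A : Set} → List A → (A → ℕ) → ℕ
∑ []       f = 0
∑ (a ∷ as) f = f a + ∑ as f

syntax ∑ L (λ a → e) = ∑[ a ∈ L ] e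

ind : Bool → ℕ
ind b = if b then 1 else 0

module _ {A : Set} where

  ∑-cong : (L : List A) {f g : A → ℕ} → (∀ a → f a ≡ g a) → ∑ L f ≡ ∑ L g
  ∑-cong []       f≗g = refl
  ∑-cong (a ∷ as) f≗g = cong₂ _+_ (f≗g a) (∑-cong as f≗g)

  ∑-zero : (L : List A) (f : A → ℕ) → (∀ a → f a ≡ 0) → ∑ L f ≡ 0
  ∑-zero []       f f≗0 = refl
  ∑-zero (a ∷ as) f f≗0 = cong₂ _+_ (f≗0 a) (∑-zero as f f≗0)

  ∑-distrib-+ : (L : List A) (f g : A → ℕ) → ∑[ a ∈ L ] (f a + g a) ≡ ∑ L f + ∑ L g
  ∑-distrib-+ []       f g = refl
  ∑-distrib-+ (a ∷ as) f g =
    trans (cong (f a + g a +_) (∑-distrib-+ as f g)) (+-interchange (f a) (g a) (∑ as f) (∑ as g))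

  ∑-*ˡ : (L : List A) (c : ℕ) (f : A → ℕ) → ∑[ a ∈ L ] (c * f a) ≡ c * ∑ L f
  ∑-*ˡ []       c f = ≡.sym (ℕ.*-zeroʳ c)
  ∑-*ˡ (a ∷ as) c f = trans (cong (c * f a +_) (∑-*ˡ as c f)) (≡.sym (ℕ.*-distribˡ-+ c (f a) _))

  ∑-*ʳ : (L : List A) (c : ℕ) (f : A → ℕ) → ∑[ a ∈ L ] (f a * c) ≡ ∑ L f * c
  ∑-*ʳ L c f = begin
    ∑[ a ∈ L ] (f a * c) ≡⟨ ∑-cong L (λ a → ℕ.*-comm (f a) c) ⟩
    ∑[ a ∈ L ] (c * f a) ≡⟨ ∑-*ˡ L c f ⟩
    c * ∑ L f            ≡⟨ ℕ.*-comm c _ ⟩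
    ∑ L f * c            ∎

  ∑-const : (L : List A) (c : ℕ) → ∑[ a ∈ L ] c ≡ length L * c
  ∑-const []       c = refl
  ∑-const (a ∷ as) c = cong (c +_) (∑-const as c)

  ∑-++ : (L M : List A) (f : A → ℕ) → ∑ (L ++ M) f ≡ ∑ L f + ∑ M f
  ∑-++ []       M f = refl
  ∑-++ (a ∷ as) M f = trans (cong (f a +_) (∑-++ as M f)) (≡.sym (ℕ.+-assoc (f a) _ _))

  sum-map : (L : List A) (f : A → ℕ) → sum (map f L) ≡ ∑ L f
  sum-map []       f = refl
  sum-map (a ∷ as) f = cong (f a +_) (sum-map as f)

  countB-cong : {p p′ : A → Bool} → (∀ a → p a ≡ p′ a) → (L : List A) → countB p L ≡ countB p′ L
  countB-cong p≗p′ []       = refl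
  countB-cong p≗p′ (a ∷ as) = cong₂ _+_ (cong ind (p≗p′ a)) (countB-cong p≗p′ as)

  countB≡∑ : (p : A → Bool) (L : List A) → countB p L ≡ ∑[ a ∈ L ] ind (p a)
  countB≡∑ p []       = refl
  countB≡∑ p (a ∷ as) = cong (ind (p a) +_) (countB≡∑ p as)

module _ {A B : Set} where

  ∑-comm : (L : List A) (M : List B) (h : A → B → ℕ) →
    ∑[ a ∈ L ] ∑[ b ∈ M ] h a b ≡ ∑[ b ∈ M ] ∑[ a ∈ L ] h a b
  ∑-comm []       M h = ≡.sym (∑-zero M _ (λ _ → refl))
  ∑-comm (a ∷ as) M h = trans (cong (∑ M (h a) +_) (∑-comm as M h))
                              (≡.sym (∑-distrib-+ M (h a) (λ b → ∑[ a′ ∈ as ] h a′ b)))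

  ∑-map : (k : A → B) (L : List A) (f : B → ℕ) → ∑ (map k L) f ≡ ∑[ a ∈ L ] f (k a)
  ∑-map k []       f = refl
  ∑-map k (a ∷ as) f = cong (f (k a) +_) (∑-map k as f)

  ∑-concatMap : (k : A → List B) (L : List A) (f : B → ℕ) →
    ∑ (concatMap k L) f ≡ ∑[ a ∈ L ] ∑ (k a) f
  ∑-concatMap k []       f = refl
  ∑-concatMap k (a ∷ as) f =
    trans (∑-++ (k a) (concatMap k as) f) (cong (∑ (k a) f +_) (∑-concatMap k as f))

  ∑-product : (L : List A) (M : List B) (f : A → ℕ) (g : B → ℕ) →
    ∑[ a ∈ L ] ∑[ b ∈ M ] (f a * g b) ≡ ∑ L f * ∑ M g
  ∑-product L M f g = trans (∑-cong L (λ a → ∑-*ˡ M (f a) g)) (∑-*ʳ L (∑ M g) f)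

ind-∧ : ∀ a b → ind (a ∧ b) ≡ ind a * ind b
ind-∧ false b = refl
ind-∧ true  b = ≡.sym (ℕ.+-identityʳ (ind b))

-- Integer polynomials

module Polynomial where
  open import Data.Integer using (+_; -[1+_]; -_; _-_)
  open import Data.Integer.Tactic.RingSolver using (solve-∀)

  ∑ℤ : {A : Set} → List A → (A → ℤ) → ℤ
  ∑ℤ []       f = + 0
  ∑ℤ (a ∷ as) f = f a ℤ.+ ∑ℤ as f

  syntax ∑ℤ L (λ a → e) = ∑ℤ[ a ∈ L ] e

  ∑ℤ-cong : {A : Set} (L : List A) {f g : A → ℤ} → (∀ a → f a ≡ g a) → ∑ℤ L f ≡ ∑ℤ L g
  ∑ℤ-cong []       f≗g = refl
  ∑ℤ-cong (a ∷ as) f≗g = cong₂ ℤ._+_ (f≗g a) (∑ℤ-cong as f≗g)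

  ∑ℤ-*ˡ : {A : Set} (L : List A) (c : ℤ) (f : A → ℤ) → ∑ℤ[ a ∈ L ] (c ℤ.* f a) ≡ c ℤ.* ∑ℤ L f
  ∑ℤ-*ˡ []       c f = ≡.sym (ℤₚ.*-zeroʳ c)
  ∑ℤ-*ˡ (a ∷ as) c f =
    trans (cong (ℤ._+_ (c ℤ.* f a)) (∑ℤ-*ˡ as c f)) (≡.sym (ℤₚ.*-distribˡ-+ c (f a) _))

  +-∑ : {A : Set} (L : List A) (f : A → ℕ) → + ∑ L f ≡ ∑ℤ[ a ∈ L ] (+ f a)
  +-∑ []       f = refl
  +-∑ (a ∷ as) f = trans (ℤₚ.pos-+ (f a) (∑ as f)) (cong (ℤ._+_ (+ f a)) (+-∑ as f))

  infixl 6 _⊕_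
  infixl 7 _·_

  _⊕_ : Poly → Poly → Poly
  []       ⊕ q        = q
  (a ∷ as) ⊕ []       = a ∷ as
  (a ∷ as) ⊕ (b ∷ bs) = a ℤ.+ b ∷ as ⊕ bs

  _·_ : ℤ → Poly → Poly
  c · p = map (c ℤ.*_) p

  timesX : Poly → Poly
  timesX p = + 0 ∷ p

  translate : ℤ → Poly → Poly
  translate c []       = []
  translate c (a ∷ as) = (a ∷ []) ⊕ (timesX s ⊕ c · s)
    where s = translate c as

  eval-⊕ : ∀ p q x → eval (p ⊕ q) x ≡ eval p x ℤ.+ eval q x
  eval-⊕ []       q        x = ≡.sym (ℤₚ.+-identityˡ _)
  eval-⊕ (a ∷ as) []       x = ≡.sym (ℤₚ.+-identityʳ _)
  eval-⊕ (a ∷ as) (b ∷ bs) x = begin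
    a ℤ.+ b ℤ.+ x ℤ.* eval (as ⊕ bs) x             ≡⟨ cong (λ t → a ℤ.+ b ℤ.+ x ℤ.* t) (eval-⊕ as bs x) ⟩
    a ℤ.+ b ℤ.+ x ℤ.* (eval as x ℤ.+ eval bs x)    ≡⟨ regroup a b x (eval as x) (eval bs x) ⟩
    a ℤ.+ x ℤ.* eval as x ℤ.+ (b ℤ.+ x ℤ.* eval bs x) ∎
    where
    regroup : ∀ a b x u v → a ℤ.+ b ℤ.+ x ℤ.* (u ℤ.+ v) ≡ a ℤ.+ x ℤ.* u ℤ.+ (b ℤ.+ x ℤ.* v)
    regroup = solve-∀

  coeff-⊕ : ∀ p q k → coeff (p ⊕ q) k ≡ coeff p k ℤ.+ coeff q k
  coeff-⊕ []       q        k       = ≡.sym (ℤₚ.+-identityˡ _)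
  coeff-⊕ (a ∷ as) []       zero    = ≡.sym (ℤₚ.+-identityʳ _)
  coeff-⊕ (a ∷ as) []       (suc k) = ≡.sym (ℤₚ.+-identityʳ _)
  coeff-⊕ (a ∷ as) (b ∷ bs) zero    = refl
  coeff-⊕ (a ∷ as) (b ∷ bs) (suc k) = coeff-⊕ as bs k

  eval-· : ∀ c p x → eval (c · p) x ≡ c ℤ.* eval p x
  eval-· c []       x = ≡.sym (ℤₚ.*-zeroʳ c)
  eval-· c (a ∷ as) x = begin
    c ℤ.* a ℤ.+ x ℤ.* eval (c · as) x    ≡⟨ cong (λ t → c ℤ.* a ℤ.+ x ℤ.* t) (eval-· c as x) ⟩
    c ℤ.* a ℤ.+ x ℤ.* (c ℤ.* eval as x)  ≡⟨ factor-out c a x (eval as x) ⟩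
    c ℤ.* (a ℤ.+ x ℤ.* eval as x)        ∎
    where
    factor-out : ∀ c a x u → c ℤ.* a ℤ.+ x ℤ.* (c ℤ.* u) ≡ c ℤ.* (a ℤ.+ x ℤ.* u)
    factor-out = solve-∀

  coeff-· : ∀ c p k → coeff (c · p) k ≡ c ℤ.* coeff p k
  coeff-· c []       k       = ≡.sym (ℤₚ.*-zeroʳ c)
  coeff-· c (a ∷ as) zero    = refl
  coeff-· c (a ∷ as) (suc k) = coeff-· c as k

  eval-timesX : ∀ p x → eval (timesX p) x ≡ x ℤ.* eval p x
  eval-timesX p x = ℤₚ.+-identityˡ _

  coeff₀≡eval₀ : ∀ p → coeff p 0 ≡ eval p (+ 0)
  coeff₀≡eval₀ []       = refl
  coeff₀≡eval₀ (a ∷ as) = ≡.sym (ℤₚ.+-identityʳ a)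

  eval-translate : ∀ c p x → eval (translate c p) x ≡ eval p (x ℤ.+ c)
  eval-translate c []       x = refl
  eval-translate c (a ∷ as) x = begin
    eval ((a ∷ []) ⊕ (timesX s ⊕ c · s)) x
      ≡⟨ eval-⊕ (a ∷ []) (timesX s ⊕ c · s) x ⟩
    eval (a ∷ []) x ℤ.+ eval (timesX s ⊕ c · s) x
      ≡⟨ cong (ℤ._+_ (eval (a ∷ []) x)) (eval-⊕ (timesX s) (c · s) x) ⟩
    eval (a ∷ []) x ℤ.+ (eval (timesX s) x ℤ.+ eval (c · s) x)
      ≡⟨ cong₂ (λ t r → eval (a ∷ []) x ℤ.+ (t ℤ.+ r)) (eval-timesX s x) (eval-· c s x) ⟩
    eval (a ∷ []) x ℤ.+ (x ℤ.* eval s x ℤ.+ c ℤ.* eval s x)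
      ≡⟨ cong (λ t → eval (a ∷ []) x ℤ.+ (x ℤ.* t ℤ.+ c ℤ.* t)) (eval-translate c as x) ⟩
    eval (a ∷ []) x ℤ.+ (x ℤ.* u ℤ.+ c ℤ.* u)
      ≡⟨ horner a x c u ⟩
    a ℤ.+ (x ℤ.+ c) ℤ.* u ∎
    where
    s = translate c as
    u = eval as (x ℤ.+ c)
    horner : ∀ a x c u → a ℤ.+ x ℤ.* + 0 ℤ.+ (x ℤ.* u ℤ.+ c ℤ.* u) ≡ a ℤ.+ (x ℤ.+ c) ℤ.* u
    horner = solve-∀

  length-⊕ : ∀ p q → length (p ⊕ q) ≡ length p ⊔ length q
  length-⊕ []       q        = refl
  length-⊕ (a ∷ as) []       = refl
  length-⊕ (a ∷ as) (b ∷ bs) = cong suc (length-⊕ as bs)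

  length-translate : ∀ c p → length (translate c p) ≡ length p
  length-translate c []       = refl
  length-translate c (a ∷ as) = begin
    length ((a ∷ []) ⊕ (timesX s ⊕ c · s))  ≡⟨ length-⊕ (a ∷ []) (timesX s ⊕ c · s) ⟩
    1 ⊔ length (timesX s ⊕ c · s)           ≡⟨ cong (1 ⊔_) (length-⊕ (timesX s) (c · s)) ⟩
    1 ⊔ (suc (length s) ⊔ length (c · s))   ≡⟨ cong (λ t → 1 ⊔ (suc (length s) ⊔ t)) (length-map (c ℤ.*_) s) ⟩
    1 ⊔ (suc (length s) ⊔ length s)         ≡⟨ cong (1 ⊔_) (ℕ.m≥n⇒m⊔n≡m (ℕ.n≤1+n (length s))) ⟩
    suc (length s)                          ≡⟨ cong suc (length-translate c as) ⟩
    suc (length as)                         ∎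
    where s = translate c as

  IsZero : Poly → Set
  IsZero p = ∀ k → coeff p k ≡ + 0

  eval-IsZero : ∀ p → IsZero p → ∀ x → eval p x ≡ + 0
  eval-IsZero []       p≡0 x = refl
  eval-IsZero (a ∷ as) p≡0 x = begin
    a ℤ.+ x ℤ.* eval as x ≡⟨ cong₂ (λ s t → s ℤ.+ x ℤ.* t) (p≡0 0) (eval-IsZero as (p≡0 ∘ suc) x) ⟩
    + 0 ℤ.+ x ℤ.* + 0     ≡⟨ trans (ℤₚ.+-identityˡ _) (ℤₚ.*-zeroʳ x) ⟩
    + 0                   ∎

  -- Induction on the length: if p = a + x·p₁ vanishes on ℕ, then a = 0 and p₁ vanishes on ℕ⁺;
  -- so p₁(x+1), of the same length as p₁, vanishes on ℕ, hence everywhere, in particular at x = -1.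
  vanishing⇒IsZero : ∀ p → (∀ q → eval p (+ q) ≡ + 0) → IsZero p
  vanishing⇒IsZero p = go (length p) p ℕ.≤-refl
    where
    go : ∀ m p → length p ≤ m → (∀ q → eval p (+ q) ≡ + 0) → IsZero p
    go m       []       _            _   k = refl
    go (suc m) (a ∷ as) (s≤s ∣as∣≤m) p≡0 = coefficients
      where
      a≡0 : a ≡ + 0
      a≡0 = trans (≡.sym (ℤₚ.+-identityʳ a)) (p≡0 0)
      as≡0⁺ : ∀ q → eval as (+ suc q) ≡ + 0
      as≡0⁺ q with ℤₚ.i*j≡0⇒i≡0∨j≡0 (+ suc q)
                     (trans (≡.sym (ℤₚ.+-identityˡ _))
                       (subst (λ t → t ℤ.+ + suc q ℤ.* eval as (+ suc q) ≡ + 0) a≡0 (p≡0 (suc q))))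
      ... | inj₂ e = e
      shifted≡0 : IsZero (translate (+ 1) as)
      shifted≡0 = go m (translate (+ 1) as)
        (subst (_≤ m) (≡.sym (length-translate (+ 1) as)) ∣as∣≤m)
        (λ q → trans (eval-translate (+ 1) as (+ q))
                 (subst (λ t → eval as t ≡ + 0) (trans (cong (λ k → + k) (ℕ.+-comm 1 q)) (≡.sym (ℤₚ.pos-+ q 1)))
                   (as≡0⁺ q)))
      as≡0 : ∀ q → eval as (+ q) ≡ + 0
      as≡0 zero    = trans (≡.sym (eval-translate (+ 1) as -[1+ 0 ]))
                           (eval-IsZero (translate (+ 1) as) shifted≡0 -[1+ 0 ])
      as≡0 (suc q) = as≡0⁺ q
      coefficients : IsZero (a ∷ as)
      coefficients zero    = a≡0
      coefficients (suc k) = go m as ∣as∣≤m as≡0 k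

  coeff-unique : ∀ p p′ → (∀ q → eval p (+ q) ≡ eval p′ (+ q)) → ∀ k → coeff p k ≡ coeff p′ k
  coeff-unique p p′ p≗p′ k = ℤₚ.i-j≡0⇒i≡j _ _ (trans (≡.sym (coeff-d k)) (d≡0 k))
    where
    d = p ⊕ -[1+ 0 ] · p′
    coeff-d : ∀ k → coeff d k ≡ coeff p k - coeff p′ k
    coeff-d k = trans (coeff-⊕ p _ k)
                  (cong (ℤ._+_ (coeff p k)) (trans (coeff-· -[1+ 0 ] p′ k) (ℤₚ.-1*i≡-i _)))
    eval-d : ∀ x → eval d x ≡ eval p x - eval p′ x
    eval-d x = trans (eval-⊕ p _ x)
                 (cong (ℤ._+_ (eval p x)) (trans (eval-· -[1+ 0 ] p′ x) (ℤₚ.-1*i≡-i _)))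
    d≡0 : IsZero d
    d≡0 = vanishing⇒IsZero d λ q → begin
      eval d (+ q)                  ≡⟨ eval-d (+ q) ⟩
      eval p (+ q) - eval p′ (+ q)  ≡⟨ cong (λ t → t - eval p′ (+ q)) (p≗p′ q) ⟩
      eval p′ (+ q) - eval p′ (+ q) ≡⟨ ℤₚ.+-inverseʳ (eval p′ (+ q)) ⟩
      + 0                           ∎

  combination : {A : Set} → List A → (A → ℤ) → (A → Poly) → Poly
  combination []       c F = []
  combination (a ∷ as) c F = c a · F a ⊕ combination as c F

  eval-combination : {A : Set} (L : List A) (c : A → ℤ) (F : A → Poly) (x : ℤ) →
    eval (combination L c F) x ≡ ∑ℤ[ a ∈ L ] (c a ℤ.* eval (F a) x)
  eval-combination []       c F x = refl
  eval-combination (a ∷ as) c F x =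
    trans (eval-⊕ (c a · F a) _ x) (cong₂ ℤ._+_ (eval-· (c a) (F a) x) (eval-combination as c F x))

  coeff-combination : {A : Set} (L : List A) (c : A → ℤ) (F : A → Poly) (k : ℕ) →
    coeff (combination L c F) k ≡ ∑ℤ[ a ∈ L ] (c a ℤ.* coeff (F a) k)
  coeff-combination []       c F k = refl
  coeff-combination (a ∷ as) c F k =
    trans (coeff-⊕ (c a · F a) _ k) (cong₂ ℤ._+_ (coeff-· (c a) (F a) k) (coeff-combination as c F k))

  combination-coeff-unique : {A : Set} (L : List A) (c : A → ℤ) (F : A → Poly) (p : Poly) →
    (∀ q → ∑ℤ[ a ∈ L ] (c a ℤ.* eval (F a) (+ q)) ≡ eval p (+ q)) →
    ∀ k → ∑ℤ[ a ∈ L ] (c a ℤ.* coeff (F a) k) ≡ coeff p k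
  combination-coeff-unique L c F p h k =
    trans (≡.sym (coeff-combination L c F k))
      (coeff-unique (combination L c F) p (λ q → trans (eval-combination L c F (+ q)) (h q)) k)

  -- Compare coefficients of x (for fixed y), then of y.
  xy-coefficient : {A : Set} (L : List A) (w : A → ℤ) (P Q : A → Poly) (m : Poly) →
    (∀ x y → ∑ℤ[ a ∈ L ] (w a ℤ.* (eval (P a) (+ x) ℤ.* eval (Q a) (+ y)))
               ≡ + x ℤ.* (+ y ℤ.* eval m (+ x ℤ.+ + y))) →
    ∑ℤ[ a ∈ L ] (w a ℤ.* (coeff (P a) 1 ℤ.* coeff (Q a) 1)) ≡ coeff m 0
  xy-coefficient L w P Q m h = begin
    ∑ℤ[ a ∈ L ] (w a ℤ.* (coeff (P a) 1 ℤ.* coeff (Q a) 1))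
      ≡⟨ ∑ℤ-cong L (λ a → ≡.sym (ℤₚ.*-assoc (w a) _ _)) ⟩
    ∑ℤ[ a ∈ L ] (w a ℤ.* coeff (P a) 1 ℤ.* coeff (Q a) 1)
      ≡⟨ combination-coeff-unique L (λ a → w a ℤ.* coeff (P a) 1) Q (timesX m) y-part 1 ⟩
    coeff m 0
      ∎
    where
    x-part : ∀ y → ∑ℤ[ a ∈ L ] (w a ℤ.* eval (Q a) (+ y) ℤ.* coeff (P a) 1) ≡ + y ℤ.* eval m (+ y)
    x-part y = begin
      ∑ℤ[ a ∈ L ] (w a ℤ.* eval (Q a) (+ y) ℤ.* coeff (P a) 1)
        ≡⟨ combination-coeff-unique L (λ a → w a ℤ.* eval (Q a) (+ y)) P my (λ x → trans
             (∑ℤ-cong L (λ a → regroup (w a) (eval (Q a) (+ y)) (eval (P a) (+ x))))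
             (trans (h x y) (≡.sym (eval-my (+ x))))) 1 ⟩
      coeff my 1
        ≡⟨ coeff-· (+ y) (timesX (translate (+ y) m)) 1 ⟩
      + y ℤ.* coeff (translate (+ y) m) 0
        ≡⟨ cong (ℤ._*_ (+ y)) (trans (coeff₀≡eval₀ (translate (+ y) m)) (eval-translate (+ y) m (+ 0))) ⟩
      + y ℤ.* eval m (+ 0 ℤ.+ + y)
        ≡⟨ cong (λ t → + y ℤ.* eval m t) (ℤₚ.+-identityˡ (+ y)) ⟩
      + y ℤ.* eval m (+ y)
        ∎
      where
      my = + y · timesX (translate (+ y) m)
      eval-my : ∀ x → eval my x ≡ x ℤ.* (+ y ℤ.* eval m (x ℤ.+ + y))
      eval-my x = begin
        eval my x
          ≡⟨ eval-· (+ y) (timesX (translate (+ y) m)) x ⟩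
        + y ℤ.* eval (timesX (translate (+ y) m)) x
          ≡⟨ cong (ℤ._*_ (+ y)) (eval-timesX (translate (+ y) m) x) ⟩
        + y ℤ.* (x ℤ.* eval (translate (+ y) m) x)
          ≡⟨ cong (λ t → + y ℤ.* (x ℤ.* t)) (eval-translate (+ y) m x) ⟩
        + y ℤ.* (x ℤ.* eval m (x ℤ.+ + y))
          ≡⟨ swap-factors (+ y) x (eval m (x ℤ.+ + y)) ⟩
        x ℤ.* (+ y ℤ.* eval m (x ℤ.+ + y))
          ∎
        where
        swap-factors : ∀ a b c → a ℤ.* (b ℤ.* c) ≡ b ℤ.* (a ℤ.* c)
        swap-factors = solve-∀
      regroup : ∀ a b c → a ℤ.* b ℤ.* c ≡ a ℤ.* (c ℤ.* b)
      regroup = solve-∀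
    y-part : ∀ y → ∑ℤ[ a ∈ L ] (w a ℤ.* coeff (P a) 1 ℤ.* eval (Q a) (+ y)) ≡ eval (timesX m) (+ y)
    y-part y = begin
      ∑ℤ[ a ∈ L ] (w a ℤ.* coeff (P a) 1 ℤ.* eval (Q a) (+ y))
        ≡⟨ ∑ℤ-cong L (λ a → regroup (w a) (coeff (P a) 1) (eval (Q a) (+ y))) ⟩
      ∑ℤ[ a ∈ L ] (w a ℤ.* eval (Q a) (+ y) ℤ.* coeff (P a) 1)
        ≡⟨ x-part y ⟩
      + y ℤ.* eval m (+ y)
        ≡⟨ eval-timesX m (+ y) ⟨
      eval (timesX m) (+ y)
        ∎
      where
      regroup : ∀ a b c → a ℤ.* b ℤ.* c ≡ a ℤ.* c ℤ.* b
      regroup = solve-∀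

  quotient₁ : Poly → Poly
  quotient₁ []       = []
  quotient₁ (a ∷ as) = eval as (+ 1) ∷ quotient₁ as

  eval-quotient₁ : ∀ p x → eval p x ≡ (x - + 1) ℤ.* eval (quotient₁ p) x ℤ.+ eval p (+ 1)
  eval-quotient₁ []       x = ≡.sym (trans (ℤₚ.+-identityʳ _) (ℤₚ.*-zeroʳ (x - + 1)))
  eval-quotient₁ (a ∷ as) x = begin
    a ℤ.+ x ℤ.* eval as x
      ≡⟨ cong (λ t → a ℤ.+ x ℤ.* t) (eval-quotient₁ as x) ⟩
    a ℤ.+ x ℤ.* ((x - + 1) ℤ.* eval (quotient₁ as) x ℤ.+ eval as (+ 1))
      ≡⟨ expand a x (eval (quotient₁ as) x) (eval as (+ 1)) ⟩
    (x - + 1) ℤ.* (eval as (+ 1) ℤ.+ x ℤ.* eval (quotient₁ as) x) ℤ.+ (a ℤ.+ + 1 ℤ.* eval as (+ 1))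
      ∎
    where
    expand : ∀ a x q r → a ℤ.+ x ℤ.* ((x - + 1) ℤ.* q ℤ.+ r) ≡ (x - + 1) ℤ.* (r ℤ.+ x ℤ.* q) ℤ.+ (a ℤ.+ + 1 ℤ.* r)
    expand = solve-∀

  factor-x[x-1] : ∀ p → eval p (+ 0) ≡ + 0 → eval p (+ 1) ≡ + 0 →
    Σ[ m ∈ Poly ] (∀ x → eval p x ≡ x ℤ.* ((x - + 1) ℤ.* eval m x)) × (coeff p 1 ≡ - eval m (+ 0))
  factor-x[x-1] []       _    _    = [] , (λ x → ≡.sym (zero-product x)) , refl
    where
    zero-product : ∀ x → x ℤ.* ((x - + 1) ℤ.* + 0) ≡ + 0
    zero-product = solve-∀
  factor-x[x-1] (a ∷ as) p₀≡0 p₁≡0 = quotient₁ as , eval-p , coeff₁-p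
    where
    a≡0 : a ≡ + 0
    a≡0 = trans (≡.sym (trans (cong (ℤ._+_ a) (ℤₚ.*-zeroˡ (eval as (+ 0)))) (ℤₚ.+-identityʳ a))) p₀≡0
    as₁≡0 : eval as (+ 1) ≡ + 0
    as₁≡0 = trans (≡.sym (trans (cong (λ t → t ℤ.+ + 1 ℤ.* eval as (+ 1)) a≡0)
                               (trans (ℤₚ.+-identityˡ _) (ℤₚ.*-identityˡ _)))) p₁≡0
    eval-p : ∀ x → eval (a ∷ as) x ≡ x ℤ.* ((x - + 1) ℤ.* eval (quotient₁ as) x)
    eval-p x = begin
      a ℤ.+ x ℤ.* eval as x
        ≡⟨ cong₂ (λ s t → s ℤ.+ x ℤ.* t) a≡0 (eval-quotient₁ as x) ⟩
      + 0 ℤ.+ x ℤ.* ((x - + 1) ℤ.* eval (quotient₁ as) x ℤ.+ eval as (+ 1))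
        ≡⟨ cong (λ t → + 0 ℤ.+ x ℤ.* ((x - + 1) ℤ.* eval (quotient₁ as) x ℤ.+ t)) as₁≡0 ⟩
      + 0 ℤ.+ x ℤ.* ((x - + 1) ℤ.* eval (quotient₁ as) x ℤ.+ + 0)
        ≡⟨ simplify x (eval (quotient₁ as) x) ⟩
      x ℤ.* ((x - + 1) ℤ.* eval (quotient₁ as) x)
        ∎
      where
      simplify : ∀ x q → + 0 ℤ.+ x ℤ.* ((x - + 1) ℤ.* q ℤ.+ + 0) ≡ x ℤ.* ((x - + 1) ℤ.* q)
      simplify = solve-∀
    coeff₁-p : coeff as 0 ≡ - eval (quotient₁ as) (+ 0)
    coeff₁-p = begin
      coeff as 0                                          ≡⟨ coeff₀≡eval₀ as ⟩
      eval as (+ 0)                                       ≡⟨ eval-quotient₁ as (+ 0) ⟩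
      (+ 0 - + 1) ℤ.* eval q (+ 0) ℤ.+ eval as (+ 1)      ≡⟨ cong (ℤ._+_ ((+ 0 - + 1) ℤ.* eval q (+ 0))) as₁≡0 ⟩
      (+ 0 - + 1) ℤ.* eval q (+ 0) ℤ.+ + 0                ≡⟨ simplify (eval q (+ 0)) ⟩
      - eval q (+ 0)                                      ∎
      where
      q = quotient₁ as
      simplify : ∀ q → (+ 0 - + 1) ℤ.* q ℤ.+ + 0 ≡ - q
      simplify = solve-∀

  +-∑∑-separable : {A B : Set} (L : List A) (M : List B) (r : A → Bool) (s : B → Bool) (K : A → B → ℕ) (c : ℤ) →
    (∀ a b → r a ≡ true → s b ≡ true → + K a b ≡ c) →
    + ∑[ a ∈ L ] ∑[ b ∈ M ] (ind (r a ∧ s b) * K a b) ≡ + ∑ L (ind ∘ r) ℤ.* (+ ∑ M (ind ∘ s) ℤ.* c)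
  +-∑∑-separable L M r s K c K≡c = rows L
    where
    S = + ∑ M (ind ∘ s) ℤ.* c
    row : ∀ a → r a ≡ true → ∀ bs → + ∑[ b ∈ bs ] (ind (s b) * K a b) ≡ + ∑ bs (ind ∘ s) ℤ.* c
    row a ra []       = ≡.sym (ℤₚ.*-zeroˡ c)
    row a ra (b ∷ bs) with s b in sb
    ... | true  = begin
      + (1 * K a b + ∑[ b′ ∈ bs ] (ind (s b′) * K a b′))   ≡⟨ ℤₚ.pos-+ (1 * K a b) _ ⟩
      + (1 * K a b) ℤ.+ + ∑[ b′ ∈ bs ] (ind (s b′) * K a b′) ≡⟨ cong₂ ℤ._+_ K≡c′ (row a ra bs) ⟩
      c ℤ.+ + ∑ bs (ind ∘ s) ℤ.* c                          ≡⟨ collect c (+ ∑ bs (ind ∘ s)) ⟩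
      (+ 1 ℤ.+ + ∑ bs (ind ∘ s)) ℤ.* c                      ≡⟨ cong (ℤ._* c) (ℤₚ.pos-+ 1 (∑ bs (ind ∘ s))) ⟨
      + (1 + ∑ bs (ind ∘ s)) ℤ.* c                          ∎
      where
      K≡c′ : + (1 * K a b) ≡ c
      K≡c′ = trans (cong (λ k → + k) (ℕ.*-identityˡ (K a b))) (K≡c a b ra sb)
      collect : ∀ c t → c ℤ.+ t ℤ.* c ≡ (+ 1 ℤ.+ t) ℤ.* c
      collect = solve-∀
    ... | false = row a ra bs
    rows : ∀ L → + ∑[ a ∈ L ] ∑[ b ∈ M ] (ind (r a ∧ s b) * K a b) ≡ + ∑ L (ind ∘ r) ℤ.* S
    rows []       = ≡.sym (ℤₚ.*-zeroˡ S)
    rows (a ∷ as) = begin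
      + (∑[ b ∈ M ] (ind (r a ∧ s b) * K a b) + ∑[ a′ ∈ as ] ∑[ b ∈ M ] (ind (r a′ ∧ s b) * K a′ b))
        ≡⟨ ℤₚ.pos-+ (∑[ b ∈ M ] (ind (r a ∧ s b) * K a b)) _ ⟩
      + ∑[ b ∈ M ] (ind (r a ∧ s b) * K a b) ℤ.+ + ∑[ a′ ∈ as ] ∑[ b ∈ M ] (ind (r a′ ∧ s b) * K a′ b)
        ≡⟨ cong₂ ℤ._+_ (row-total (r a) refl) (rows as) ⟩
      + ind (r a) ℤ.* S ℤ.+ + ∑ as (ind ∘ r) ℤ.* S
        ≡⟨ ℤₚ.*-distribʳ-+ S (+ ind (r a)) (+ ∑ as (ind ∘ r)) ⟨
      (+ ind (r a) ℤ.+ + ∑ as (ind ∘ r)) ℤ.* S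
        ≡⟨ cong (ℤ._* S) (ℤₚ.pos-+ (ind (r a)) _) ⟨
      + (ind (r a) + ∑ as (ind ∘ r)) ℤ.* S
        ∎
      where
      row-total : ∀ t → r a ≡ t → + ∑[ b ∈ M ] (ind (r a ∧ s b) * K a b) ≡ + ind t ℤ.* S
      row-total true  ra rewrite ra = trans (row a ra M) (≡.sym (ℤₚ.*-identityˡ S))
      row-total false ra rewrite ra = trans (cong (λ k → + k) (∑-zero M _ (λ _ → refl))) (≡.sym (ℤₚ.*-zeroˡ S))


open Polynomial

-- Enumerations and counting

module _ {A : Set} (_≟_ : DecidableEquality A) where

  multiplicity : List A → A → ℕ
  multiplicity L a = ∑[ b ∈ L ] ind (does (b ≟ a))

  record Enumerates (L : List A) : Set where
    constructor enumerates
    field occursOnce : ∀ a → multiplicity L a ≡ 1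

  open Enumerates public

  countB-partition : {B : Set} (L : List A) → Enumerates L → (key : B → A) (P : B → Bool) (M : List B) →
    countB P M ≡ ∑[ a ∈ L ] countB (λ b → P b ∧ does (key b ≟ a)) M
  countB-partition L enum key P M = begin
    countB P M                                             ≡⟨ countB≡∑ P M ⟩
    ∑[ b ∈ M ] ind (P b)                                   ≡⟨ ∑-cong M split ⟨
    ∑[ b ∈ M ] ∑[ a ∈ L ] ind (P b ∧ does (key b ≟ a))     ≡⟨ ∑-comm M L _ ⟩
    ∑[ a ∈ L ] ∑[ b ∈ M ] ind (P b ∧ does (key b ≟ a))     ≡⟨ ∑-cong L (λ a → countB≡∑ _ M) ⟨
    ∑[ a ∈ L ] countB (λ b → P b ∧ does (key b ≟ a)) M     ∎
    where
    split : ∀ b → ∑[ a ∈ L ] ind (P b ∧ does (key b ≟ a)) ≡ ind (P b)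
    split b = begin
      ∑[ a ∈ L ] ind (P b ∧ does (key b ≟ a))            ≡⟨ ∑-cong L (λ a → ind-∧ (P b) _) ⟩
      ∑[ a ∈ L ] (ind (P b) * ind (does (key b ≟ a)))    ≡⟨ ∑-cong L (λ a → cong (λ t → ind (P b) * ind t)
                                                              (does-⇔ (mk⇔ ≡.sym ≡.sym) (key b ≟ a) (a ≟ key b))) ⟩
      ∑[ a ∈ L ] (ind (P b) * ind (does (a ≟ key b)))    ≡⟨ ∑-*ˡ L (ind (P b)) _ ⟩
      ind (P b) * multiplicity L (key b)                 ≡⟨ cong (ind (P b) *_) (occursOnce enum (key b)) ⟩
      ind (P b) * 1                                      ≡⟨ ℕ.*-identityʳ (ind (P b)) ⟩
      ind (P b)                                          ∎

module _ {A B : Set} {_≟ᴬ_ : DecidableEquality A} {_≟ᴮ_ : DecidableEquality B}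
         {LA : List A} {LB : List B} (enumA : Enumerates _≟ᴬ_ LA) (enumB : Enumerates _≟ᴮ_ LB)
         (P : A → Bool) (Q : B → Bool) (f : A → B) (g : B → A)
         (f-Q : ∀ a → P a ≡ true → Q (f a) ≡ true) (g-P : ∀ b → Q b ≡ true → P (g b) ≡ true)
         (g∘f : ∀ a → P a ≡ true → g (f a) ≡ a) (f∘g : ∀ b → Q b ≡ true → f (g b) ≡ b) where

  private
    fibre : ∀ b → countB (λ a → P a ∧ does (f a ≟ᴮ b)) LA ≡ ind (Q b)
    fibre b with Q b in Qb
    ... | true = trans (countB≡∑ _ LA) (trans (∑-cong LA is-g-b) (occursOnce enumA (g b)))
      where
      is-g-b : ∀ a → ind (P a ∧ does (f a ≟ᴮ b)) ≡ ind (does (a ≟ᴬ g b))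
      is-g-b a with P a in Pa | f a ≟ᴮ b | a ≟ᴬ g b
      ... | true  | yes refl | yes _    = refl
      ... | true  | yes refl | no  a≢gb = contradiction (≡.sym (g∘f a Pa)) a≢gb
      ... | true  | no  fa≢b | yes refl = contradiction (f∘g b Qb) fa≢b
      ... | true  | no  _    | no  _    = refl
      ... | false | _        | no  _    = refl
      ... | false | _        | yes refl = contradiction (trans (≡.sym Pa) (g-P b Qb)) λ ()
    ... | false = trans (countB≡∑ _ LA) (∑-zero LA _ no-preimage)
      where
      no-preimage : ∀ a → ind (P a ∧ does (f a ≟ᴮ b)) ≡ 0
      no-preimage a with P a in Pa | f a ≟ᴮ b
      ... | true  | yes refl = contradiction (trans (≡.sym Qb) (f-Q a Pa)) λ ()
      ... | true  | no  _    = refl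
      ... | false | _        = refl

  countB-bijection : countB P LA ≡ countB Q LB
  countB-bijection = begin
    countB P LA                                              ≡⟨ countB-partition _≟ᴮ_ LB enumB f P LA ⟩
    ∑[ b ∈ LB ] countB (λ a → P a ∧ does (f a ≟ᴮ b)) LA      ≡⟨ ∑-cong LB fibre ⟩
    ∑[ b ∈ LB ] ind (Q b)                                    ≡⟨ countB≡∑ Q LB ⟨
    countB Q LB                                              ∎

∑-allFin-suc : ∀ n (f : Fin (suc n) → ℕ) → ∑ (allFin (suc n)) f ≡ f zero + ∑[ i ∈ allFin n ] f (suc i)
∑-allFin-suc n f = cong (f zero +_) (begin
  ∑ (tabulate suc) f            ≡⟨ cong (λ L → ∑ L f) (map-tabulate id suc) ⟨
  ∑ (map suc (allFin n)) f      ≡⟨ ∑-map suc (allFin n) f ⟩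
  ∑[ i ∈ allFin n ] f (suc i)   ∎)

allFin-enumerates : ∀ n → Enumerates Fin._≟_ (allFin n)
allFin-enumerates n = enumerates (once n)
  where
  once : ∀ n i → multiplicity Fin._≟_ (allFin n) i ≡ 1
  once (suc n) zero    =
    trans (∑-allFin-suc n (λ j → ind (does (j Fin.≟ zero)))) (cong suc (∑-zero (allFin n) _ (λ _ → refl)))
  once (suc n) (suc i) =
    trans (∑-allFin-suc n (λ j → ind (does (j Fin.≟ suc i)))) (once n i)

maybe-enumerates : {A : Set} {_≟_ : DecidableEquality A} {L : List A} →
  Enumerates _≟_ L → Enumerates (Maybe.≡-dec _≟_) (nothing ∷ map just L)
maybe-enumerates {L = L} enum = enumerates λ where
  nothing  → cong suc (trans (∑-map just L _) (∑-zero L _ (λ _ → refl)))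
  (just a) → trans (∑-map just L _) (occursOnce enum a)

×-≡-dec : {A B : Set} → DecidableEquality A → DecidableEquality B → DecidableEquality (A × B)
×-≡-dec _≟₁_ _≟₂_ (a , b) (a′ , b′) = map′ (uncurry (cong₂ _,_)) ,-injective (a ≟₁ a′ ×-dec b ≟₂ b′)

pairs : {A B : Set} → List A → List B → List (A × B)
pairs LA LB = concatMap (λ a → map (a ,_) LB) LA

∑-pairs : {A B : Set} (LA : List A) (LB : List B) (h : A × B → ℕ) →
  ∑ (pairs LA LB) h ≡ ∑[ a ∈ LA ] ∑[ b ∈ LB ] h (a , b)
∑-pairs LA LB h = trans (∑-concatMap _ LA h) (∑-cong LA (λ a → ∑-map (a ,_) LB h))

pairs-enumerates : {A B : Set} {_≟ᴬ_ : DecidableEquality A} {_≟ᴮ_ : DecidableEquality B}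
  {LA : List A} {LB : List B} → Enumerates _≟ᴬ_ LA → Enumerates _≟ᴮ_ LB →
  Enumerates (×-≡-dec _≟ᴬ_ _≟ᴮ_) (pairs LA LB)
pairs-enumerates {_≟ᴬ_ = _≟ᴬ_} {_≟ᴮ_} {LA} {LB} enumA enumB = enumerates λ (a , b) → begin
  ∑ (pairs LA LB) _
    ≡⟨ ∑-pairs LA LB _ ⟩
  ∑[ a′ ∈ LA ] ∑[ b′ ∈ LB ] ind (does (a′ ≟ᴬ a) ∧ does (b′ ≟ᴮ b))
    ≡⟨ ∑-cong LA (λ a′ → ∑-cong LB (λ b′ → ind-∧ (does (a′ ≟ᴬ a)) _)) ⟩
  ∑[ a′ ∈ LA ] ∑[ b′ ∈ LB ] (ind (does (a′ ≟ᴬ a)) * ind (does (b′ ≟ᴮ b)))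
    ≡⟨ ∑-product LA LB (λ a′ → ind (does (a′ ≟ᴬ a))) (λ b′ → ind (does (b′ ≟ᴮ b))) ⟩
  multiplicity _≟ᴬ_ LA a * multiplicity _≟ᴮ_ LB b
    ≡⟨ cong₂ _*_ (occursOnce enumA a) (occursOnce enumB b) ⟩
  1 ∎

allVecs-enumerates : {A : Set} {_≟_ : DecidableEquality A} {L : List A} →
  Enumerates _≟_ L → ∀ k → Enumerates (Vec.≡-dec _≟_) (allVecs L k)
allVecs-enumerates enum zero    = enumerates λ where [] → refl
allVecs-enumerates {_≟_ = _≟_} {L} enum (suc k) = enumerates λ where
  (a ∷ v) → begin
    ∑ (concatMap (λ x → map (x ∷_) (allVecs L k)) L) _
      ≡⟨ ∑-concatMap _ L _ ⟩
    ∑[ x ∈ L ] ∑ (map (x ∷_) (allVecs L k)) _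
      ≡⟨ ∑-cong L (λ x → ∑-map (x ∷_) (allVecs L k) _) ⟩
    ∑[ x ∈ L ] ∑[ w ∈ allVecs L k ] ind (does (x ≟ a) ∧ does (Vec.≡-dec _≟_ w v))
      ≡⟨ ∑-cong L (λ x → ∑-cong (allVecs L k) (λ w → ind-∧ (does (x ≟ a)) _)) ⟩
    ∑[ x ∈ L ] ∑[ w ∈ allVecs L k ] (ind (does (x ≟ a)) * ind (does (Vec.≡-dec _≟_ w v)))
      ≡⟨ ∑-product L (allVecs L k) (λ x → ind (does (x ≟ a))) (λ w → ind (does (Vec.≡-dec _≟_ w v))) ⟩
    multiplicity _≟_ L a * multiplicity (Vec.≡-dec _≟_) (allVecs L k) v
      ≡⟨ cong₂ _*_ (occursOnce enum a) (occursOnce (allVecs-enumerates enum k) v) ⟩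
    1 ∎

allSubsets-enumerates : ∀ k → Enumerates (Vec.≡-dec Bool._≟_) (allSubsets k)
allSubsets-enumerates = allVecs-enumerates (enumerates λ where
  false → refl
  true  → refl)

lookup-≗⇒≡ : {A : Set} {k : ℕ} {v w : Vec A k} → (∀ i → lookup v i ≡ lookup w i) → v ≡ w
lookup-≗⇒≡ {v = v} {w} v≗w =
  trans (≡.sym (Vec.tabulate∘lookup v)) (trans (Vec.tabulate-cong v≗w) (Vec.tabulate∘lookup w))

∧-true⁺ : ∀ {a b} → a ≡ true → b ≡ true → a ∧ b ≡ true
∧-true⁺ refl refl = refl

not-∨-not : ∀ {a b} → a ≡ true → (not a ∨ not b) ≡ true → b ≡ false
not-∨-not {b = false} refl _ = refl

allB⁻ : {A : Set} (L : List A) (p : A → Bool) → allB L p ≡ true → ∀ {a} → a ∈ L → p a ≡ true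
allB⁻ (x ∷ xs) p h (here refl) = Bool.∧-conicalˡ (p x) _ h
allB⁻ (x ∷ xs) p h (there a∈)  = allB⁻ xs p (Bool.∧-conicalʳ (p x) _ h) a∈

allB⁺ : {A : Set} (L : List A) (p : A → Bool) → (∀ a → p a ≡ true) → allB L p ≡ true
allB⁺ []       p h = refl
allB⁺ (x ∷ xs) p h = ∧-true⁺ (h x) (allB⁺ xs p h)

allB-allFin⁻ : ∀ {k} (p : Fin k → Bool) → allB (allFin k) p ≡ true → ∀ i → p i ≡ true
allB-allFin⁻ p h i = allB⁻ _ p h (∈-allFin i)

-- Proper colourings

_≟ᶜ_ : ∀ {q} → DecidableEquality (Maybe (Fin q))
_≟ᶜ_ = Maybe.≡-dec Fin._≟_

colourOptions : (q : ℕ) → List (Maybe (Fin q))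
colourOptions q = nothing ∷ map just (allFin q)

colourOptions-enumerates : ∀ q → Enumerates _≟ᶜ_ (colourOptions q)
colourOptions-enumerates q = maybe-enumerates (allFin-enumerates q)

colourings : (q k : ℕ) → List (Vec (Maybe (Fin q)) k)
colourings q k = allVecs (colourOptions q) k

colourings-enumerates : ∀ q k → Enumerates (Vec.≡-dec _≟ᶜ_) (colourings q k)
colourings-enumerates q k = allVecs-enumerates (colourOptions-enumerates q) k

eqMaybeFin≡does : ∀ {q} (a b : Maybe (Fin q)) → eqMaybeFin a b ≡ does (a ≟ᶜ b)
eqMaybeFin≡does (just a) (just b) = isYes≗does (a Fin.≟ b)
eqMaybeFin≡does (just a) nothing  = refl
eqMaybeFin≡does nothing  (just b) = refl
eqMaybeFin≡does nothing  nothing  = refl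

record IsProper (G : Graph) (S : Subset (n G)) {q : ℕ} (c : Vec (Maybe (Fin q)) (n G)) : Set where
  field
    support   : ∀ w → lookup S w ≡ isJust (lookup c w)
    separates : ∀ u v → lookup S u ≡ true → lookup S v ≡ true → adj G u v ≡ true → lookup c u ≢ lookup c v

module _ (G : Graph) (S : Subset (n G)) {q : ℕ} (c : Vec (Maybe (Fin q)) (n G)) where

  private
    support⁻ : ∀ s (m : Maybe (Fin q)) → (if s then isJust m else not (isJust m)) ≡ true → s ≡ isJust m
    support⁻ true  (just _) _ = refl
    support⁻ false nothing  _ = refl

    support⁺ : ∀ s (m : Maybe (Fin q)) → s ≡ isJust m → (if s then isJust m else not (isJust m)) ≡ true
    support⁺ .true  (just _) refl = refl
    support⁺ .false nothing  refl = refl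

  isProperColouring⇒IsProper : isProperColouring G S c ≡ true → IsProper G S c
  isProperColouring⇒IsProper proper = record { support = support ; separates = separates }
    where
    edgeCondition : Fin (n G) → Fin (n G) → Bool
    edgeCondition u v = not (lookup S u ∧ lookup S v ∧ adj G u v) ∨ not (eqMaybeFin (lookup c u) (lookup c v))
    atVertex : ∀ v → ((if lookup S v then isJust (lookup c v) else not (isJust (lookup c v)))
                      ∧ allB (allFin (n G)) (λ u → edgeCondition u v)) ≡ true
    atVertex = allB-allFin⁻ _ proper
    support : ∀ w → lookup S w ≡ isJust (lookup c w)
    support w = support⁻ (lookup S w) (lookup c w) (Bool.∧-conicalˡ _ _ (atVertex w))
    separates : ∀ u v → lookup S u ≡ true → lookup S v ≡ true → adj G u v ≡ true → lookup c u ≢ lookup c v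
    separates u v Su Sv uv cu≡cv = contradiction (trans (≡.sym differ) same) λ ()
      where
      differ : eqMaybeFin (lookup c u) (lookup c v) ≡ false
      differ = not-∨-not (∧-true⁺ Su (∧-true⁺ Sv uv))
                 (allB-allFin⁻ (λ u → edgeCondition u v) (Bool.∧-conicalʳ _ _ (atVertex v)) u)
      same : eqMaybeFin (lookup c u) (lookup c v) ≡ true
      same = trans (eqMaybeFin≡does (lookup c u) (lookup c v)) (dec-true (lookup c u ≟ᶜ lookup c v) cu≡cv)

  IsProper⇒isProperColouring : IsProper G S c → isProperColouring G S c ≡ true
  IsProper⇒isProperColouring proper = allB⁺ (allFin (n G)) _ λ v →
    ∧-true⁺ (support⁺ (lookup S v) (lookup c v) (IsProper.support proper v))
            (allB⁺ (allFin (n G)) _ λ u → edgeCondition u v)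
    where
    edgeCondition : ∀ u v →
      (not (lookup S u ∧ lookup S v ∧ adj G u v) ∨ not (eqMaybeFin (lookup c u) (lookup c v))) ≡ true
    edgeCondition u v with lookup S u in Su | lookup S v in Sv | adj G u v in uv
    ... | false | _     | _     = refl
    ... | true  | false | _     = refl
    ... | true  | true  | false = refl
    ... | true  | true  | true
      rewrite eqMaybeFin≡does (lookup c u) (lookup c v) with lookup c u ≟ᶜ lookup c v
    ...   | yes cu≡cv = contradiction cu≡cv (IsProper.separates proper u v Su Sv uv)
    ...   | no  _     = refl

colourings-zero : ∀ k → colourings 0 k ≡ replicate k nothing ∷ []
colourings-zero zero    = refl
colourings-zero (suc k) rewrite colourings-zero k = refl

numColourings-zero : (G : Graph) (S : Subset (n G)) →
  numColourings G S 0 ≡ ind (isProperColouring G S (replicate (n G) nothing))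
numColourings-zero G S =
  trans (cong (countB (isProperColouring G S)) (colourings-zero (n G))) (ℕ.+-identityʳ _)

numColourings-zero-nonempty : (G : Graph) (S : Subset (n G)) (w : Fin (n G)) →
  lookup S w ≡ true → numColourings G S 0 ≡ 0
numColourings-zero-nonempty G S w Sw = trans (numColourings-zero G S) (cong ind improper)
  where
  improper : isProperColouring G S (replicate (n G) nothing) ≡ false
  improper with isProperColouring G S (replicate (n G) nothing) in proper
  ... | false = proper
  ... | true  = contradiction
    (trans (≡.sym Sw) (trans (IsProper.support (isProperColouring⇒IsProper G S (replicate (n G) nothing) proper) w)
                             (cong isJust (Vec.lookup-replicate w nothing))))
    λ ()

numColourings-zero-empty : (G : Graph) (S : Subset (n G)) →
  (∀ w → lookup S w ≡ false) → numColourings G S 0 ≡ 1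
numColourings-zero-empty G S S≡∅ = trans (numColourings-zero G S) (cong ind (IsProper⇒isProperColouring G S _ nowhere))
  where
  nowhere : IsProper G S (replicate (n G) nothing)
  nowhere = record
    { support   = λ w → trans (S≡∅ w) (cong isJust (≡.sym (Vec.lookup-replicate w nothing)))
    ; separates = λ u _ Su _ _ _ → contradiction (trans (≡.sym Su) (S≡∅ u)) λ ()
    }

_⊆ᵇ_ : ∀ {k} → Subset k → Subset k → Bool
U ⊆ᵇ S = allB (allFin _) (λ w → not (lookup U w) ∨ lookup S w)

⊆ᵇ⁻ : ∀ {k} {U S : Subset k} → U ⊆ᵇ S ≡ true → ∀ w → lookup U w ≡ true → lookup S w ≡ true
⊆ᵇ⁻ {U = U} {S} U⊆S w Uw with allB-allFin⁻ (λ w → not (lookup U w) ∨ lookup S w) U⊆S w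
... | condition rewrite Uw = condition

lookup-─ : ∀ {k} (S U : Subset k) w → lookup (S ─ U) w ≡ lookup S w ∧ not (lookup U w)
lookup-─ (s ∷ S) (true  ∷ U) zero    = ≡.sym (Bool.∧-zeroʳ s)
lookup-─ (s ∷ S) (false ∷ U) zero    = ≡.sym (Bool.∧-identityʳ s)
lookup-─ (s ∷ S) (_     ∷ U) (suc w) = lookup-─ S U w

Separates : ∀ {k} → Subset k → Fin k → Fin k → Subset k → Bool
Separates S u v U = U ⊆ᵇ S ∧ (lookup U u ∧ not (lookup U v))

-- Splitting the colours

-- The first x colours of Fin (x + y) are red, the last y are blue.
module RedBlue (x y : ℕ) where

  red : Maybe (Fin (x + y)) → Maybe (Fin x)
  red nothing  = nothing
  red (just k) = [ just , const nothing ]′ (splitAt x k)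

  blue : Maybe (Fin (x + y)) → Maybe (Fin y)
  blue nothing  = nothing
  blue (just k) = [ const nothing , just ]′ (splitAt x k)

  merge : Maybe (Fin x) → Maybe (Fin y) → Maybe (Fin (x + y))
  merge (just i) _        = just (join x y (inj₁ i))
  merge nothing  (just j) = just (join x y (inj₂ j))
  merge nothing  nothing  = nothing

  isRed isBlue : Maybe (Fin (x + y)) → Bool
  isRed  = isJust ∘ red
  isBlue = isJust ∘ blue

  ≡join-splitAt : ∀ k {s} → splitAt x k ≡ s → k ≡ join x y s
  ≡join-splitAt k split = trans (≡.sym (Fin.join-splitAt x y k)) (cong (join x y) split)

  merge-red-blue : ∀ m → merge (red m) (blue m) ≡ m
  merge-red-blue nothing  = refl
  merge-red-blue (just k) with splitAt x k in split
  ... | inj₁ i = cong just (≡.sym (≡join-splitAt k split))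
  ... | inj₂ j = cong just (≡.sym (≡join-splitAt k split))

  red-merge : ∀ a b → red (merge a b) ≡ a
  red-merge (just i) b        rewrite Fin.splitAt-join x y (inj₁ i) = refl
  red-merge nothing  (just j) rewrite Fin.splitAt-join x y (inj₂ j) = refl
  red-merge nothing  nothing  = refl

  blue-merge : ∀ a b → isJust a ∧ isJust b ≡ false → blue (merge a b) ≡ b
  blue-merge (just i) nothing  _ rewrite Fin.splitAt-join x y (inj₁ i) = refl
  blue-merge nothing  (just j) _ rewrite Fin.splitAt-join x y (inj₂ j) = refl
  blue-merge nothing  nothing  _ = refl

  isJust-merge : ∀ a b → isJust (merge a b) ≡ isJust a ∨ isJust b
  isJust-merge (just i) b        = refl
  isJust-merge nothing  (just j) = refl
  isJust-merge nothing  nothing  = refl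

  isRed⇒isJust : ∀ m → isRed m ≡ true → isJust m ≡ true
  isRed⇒isJust (just k) _ = refl

  isBlue⇒isJust : ∀ m → isBlue m ≡ true → isJust m ≡ true
  isBlue⇒isJust (just k) _ = refl

  isBlue⇒¬isRed : ∀ m → isBlue m ≡ true → isRed m ≡ false
  isBlue⇒¬isRed (just k) blue with splitAt x k
  ... | inj₂ _ = refl

  isJust∧¬isRed : ∀ m → isJust m ∧ not (isRed m) ≡ isBlue m
  isJust∧¬isRed nothing  = refl
  isJust∧¬isRed (just k) with splitAt x k
  ... | inj₁ _ = refl
  ... | inj₂ _ = refl

  red≡just : ∀ m {i} → red m ≡ just i → m ≡ just (join x y (inj₁ i))
  red≡just (just k) red≡i with splitAt x k in split
  red≡just (just k) refl | inj₁ i = cong just (≡join-splitAt k split)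

  blue≡just : ∀ m {j} → blue m ≡ just j → m ≡ just (join x y (inj₂ j))
  blue≡just (just k) blue≡j with splitAt x k in split
  blue≡just (just k) refl | inj₂ j = cong just (≡join-splitAt k split)

  red-injective : ∀ m m′ → isRed m ≡ true → red m ≡ red m′ → m ≡ m′
  red-injective m m′ _ red≡ with red m in red≡i
  ... | just i = trans (red≡just m red≡i) (≡.sym (red≡just m′ (≡.sym red≡)))

  blue-injective : ∀ m m′ → isBlue m ≡ true → blue m ≡ blue m′ → m ≡ m′
  blue-injective m m′ _ blue≡ with blue m in blue≡j
  ... | just j = trans (blue≡just m blue≡j) (≡.sym (blue≡just m′ (≡.sym blue≡)))

module Splitting (G : Graph) (S : Subset (n G)) (u v : Fin (n G)) (Sv : lookup S v ≡ true) (x y : ℕ) where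
  open RedBlue x y

  private
    N = n G

  RedBlueProper : Vec (Maybe (Fin (x + y))) N → Bool
  RedBlueProper c = isProperColouring G S c ∧ (isRed (lookup c u) ∧ isBlue (lookup c v))

  SplitProper : Subset N × Vec (Maybe (Fin x)) N × Vec (Maybe (Fin y)) N → Bool
  SplitProper (U , c₁ , c₂) = Separates S u v U ∧ (isProperColouring G U c₁ ∧ isProperColouring G (S ─ U) c₂)

  split : Vec (Maybe (Fin (x + y))) N → Subset N × Vec (Maybe (Fin x)) N × Vec (Maybe (Fin y)) N
  split c = Vec.map isRed c , Vec.map red c , Vec.map blue c

  glue : Subset N × Vec (Maybe (Fin x)) N × Vec (Maybe (Fin y)) N → Vec (Maybe (Fin (x + y))) N
  glue (U , c₁ , c₂) = zipWith merge c₁ c₂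

  split-proper : ∀ c → RedBlueProper c ≡ true → SplitProper (split c) ≡ true
  split-proper c redBlue =
    ∧-true⁺ (∧-true⁺ U⊆S (∧-true⁺ U-u (cong not U-v)))
            (∧-true⁺ (IsProper⇒isProperColouring G U c₁ properRed)
                     (IsProper⇒isProperColouring G (S ─ U) c₂ properBlue))
    where
    U  = Vec.map isRed c
    c₁ = Vec.map red c
    c₂ = Vec.map blue c
    properS : isProperColouring G S c ≡ true
    properS = Bool.∧-conicalˡ _ _ redBlue
    red-u : isRed (lookup c u) ≡ true
    red-u = Bool.∧-conicalˡ _ (isBlue (lookup c v)) (Bool.∧-conicalʳ (isProperColouring G S c) _ redBlue)
    blue-v : isBlue (lookup c v) ≡ true
    blue-v = Bool.∧-conicalʳ (isRed (lookup c u)) _ (Bool.∧-conicalʳ (isProperColouring G S c) _ redBlue)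
    open IsProper (isProperColouring⇒IsProper G S c properS)
    U-lookup : ∀ w → lookup U w ≡ isRed (lookup c w)
    U-lookup w = Vec.lookup-map w isRed c
    ─-lookup : ∀ w → lookup (S ─ U) w ≡ isBlue (lookup c w)
    ─-lookup w = begin
      lookup (S ─ U) w                             ≡⟨ lookup-─ S U w ⟩
      lookup S w ∧ not (lookup U w)                ≡⟨ cong₂ (λ s t → s ∧ not t) (support w) (U-lookup w) ⟩
      isJust (lookup c w) ∧ not (isRed (lookup c w)) ≡⟨ isJust∧¬isRed (lookup c w) ⟩
      isBlue (lookup c w)                          ∎
    inS : ∀ w → isJust (lookup c w) ≡ true → lookup S w ≡ true
    inS w cw = trans (support w) cw
    U⊆S : U ⊆ᵇ S ≡ true
    U⊆S = allB⁺ (allFin N) _ λ w → subset w (isRed (lookup c w)) (U-lookup w)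
      where
      subset : ∀ w r → lookup U w ≡ r → (not (lookup U w) ∨ lookup S w) ≡ true
      subset w false Uw rewrite Uw = refl
      subset w true  Uw rewrite Uw = inS w (isRed⇒isJust (lookup c w) (trans (≡.sym (U-lookup w)) Uw))
    U-u : lookup U u ≡ true
    U-u = trans (U-lookup u) red-u
    U-v : lookup U v ≡ false
    U-v = trans (U-lookup v) (isBlue⇒¬isRed (lookup c v) blue-v)
    properRed : IsProper G U c₁
    properRed = record
      { support   = λ w → trans (U-lookup w) (cong isJust (≡.sym (Vec.lookup-map w red c)))
      ; separates = λ a b Ua Ub ab c₁a≡c₁b →
          let red-a = trans (≡.sym (U-lookup a)) Ua
              red-b = trans (≡.sym (U-lookup b)) Ub
          in separates a b (inS a (isRed⇒isJust _ red-a)) (inS b (isRed⇒isJust _ red-b)) ab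
               (red-injective _ _ red-a (trans (≡.sym (Vec.lookup-map a red c))
                                                (trans c₁a≡c₁b (Vec.lookup-map b red c))))
      }
    properBlue : IsProper G (S ─ U) c₂
    properBlue = record
      { support   = λ w → trans (─-lookup w) (cong isJust (≡.sym (Vec.lookup-map w blue c)))
      ; separates = λ a b Da Db ab c₂a≡c₂b →
          let blue-a = trans (≡.sym (─-lookup a)) Da
              blue-b = trans (≡.sym (─-lookup b)) Db
          in separates a b (inS a (isBlue⇒isJust _ blue-a)) (inS b (isBlue⇒isJust _ blue-b)) ab
               (blue-injective _ _ blue-a (trans (≡.sym (Vec.lookup-map a blue c))
                                                  (trans c₂a≡c₂b (Vec.lookup-map b blue c))))
      }

  glue∘split : ∀ c → glue (split c) ≡ c
  glue∘split c = lookup-≗⇒≡ λ w → begin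
    lookup (zipWith merge (Vec.map red c) (Vec.map blue c)) w
      ≡⟨ Vec.lookup-zipWith merge w (Vec.map red c) (Vec.map blue c) ⟩
    merge (lookup (Vec.map red c) w) (lookup (Vec.map blue c) w)
      ≡⟨ cong₂ merge (Vec.lookup-map w red c) (Vec.lookup-map w blue c) ⟩
    merge (red (lookup c w)) (blue (lookup c w))
      ≡⟨ merge-red-blue (lookup c w) ⟩
    lookup c w
      ∎

  private
    module Glued (U : Subset N) (c₁ : Vec (Maybe (Fin x)) N) (c₂ : Vec (Maybe (Fin y)) N)
                 (splitProper : SplitProper (U , c₁ , c₂) ≡ true) where

      c = glue (U , c₁ , c₂)
      separatesU : Separates S u v U ≡ true
      separatesU = Bool.∧-conicalˡ (Separates S u v U) _ splitProper
      U⊆S : ∀ w → lookup U w ≡ true → lookup S w ≡ true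
      U⊆S = ⊆ᵇ⁻ {U = U} {S} (Bool.∧-conicalˡ (U ⊆ᵇ S) _ separatesU)
      U-u : lookup U u ≡ true
      U-u = Bool.∧-conicalˡ (lookup U u) _ (Bool.∧-conicalʳ (U ⊆ᵇ S) _ separatesU)
      U-v : lookup U v ≡ false
      U-v = trans (≡.sym (Bool.not-involutive (lookup U v)))
                  (cong not (Bool.∧-conicalʳ (lookup U u) _ (Bool.∧-conicalʳ (U ⊆ᵇ S) _ separatesU)))
      open IsProper (isProperColouring⇒IsProper G U c₁
                       (Bool.∧-conicalˡ _ _ (Bool.∧-conicalʳ (Separates S u v U) _ splitProper)))
        public renaming (support to support₁; separates to separates₁)
      open IsProper (isProperColouring⇒IsProper G (S ─ U) c₂
                       (Bool.∧-conicalʳ (isProperColouring G U c₁) _ (Bool.∧-conicalʳ (Separates S u v U) _ splitProper)))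
        public renaming (support to support₂; separates to separates₂)

      c-lookup : ∀ w → lookup c w ≡ merge (lookup c₁ w) (lookup c₂ w)
      c-lookup w = Vec.lookup-zipWith merge w c₁ c₂

      disjoint : ∀ w → isJust (lookup c₁ w) ∧ isJust (lookup c₂ w) ≡ false
      disjoint w = begin
        isJust (lookup c₁ w) ∧ isJust (lookup c₂ w)  ≡⟨ cong₂ _∧_ (support₁ w) (support₂ w) ⟨
        lookup U w ∧ lookup (S ─ U) w                ≡⟨ cong (lookup U w ∧_) (lookup-─ S U w) ⟩
        lookup U w ∧ (lookup S w ∧ not (lookup U w)) ≡⟨ a∧b∧¬a (lookup U w) (lookup S w) ⟩
        false                                        ∎
        where
        a∧b∧¬a : ∀ a b → a ∧ (b ∧ not a) ≡ false
        a∧b∧¬a true  b = Bool.∧-zeroʳ b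
        a∧b∧¬a false b = refl

      red-c : ∀ w → red (lookup c w) ≡ lookup c₁ w
      red-c w = trans (cong red (c-lookup w)) (red-merge _ _)

      blue-c : ∀ w → blue (lookup c w) ≡ lookup c₂ w
      blue-c w = trans (cong blue (c-lookup w)) (blue-merge _ _ (disjoint w))

      proper : IsProper G S c
      proper = record { support = support ; separates = separates }
        where
        support : ∀ w → lookup S w ≡ isJust (lookup c w)
        support w = ≡.sym (begin
          isJust (lookup c w)                          ≡⟨ cong isJust (c-lookup w) ⟩
          isJust (merge (lookup c₁ w) (lookup c₂ w))   ≡⟨ isJust-merge _ _ ⟩
          isJust (lookup c₁ w) ∨ isJust (lookup c₂ w)  ≡⟨ cong₂ _∨_ (support₁ w) (support₂ w) ⟨
          lookup U w ∨ lookup (S ─ U) w                ≡⟨ cong (lookup U w ∨_) (lookup-─ S U w) ⟩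
          lookup U w ∨ (lookup S w ∧ not (lookup U w)) ≡⟨ absorb (lookup U w) (lookup S w) (U⊆S w) ⟩
          lookup S w                                   ∎)
          where
          absorb : ∀ a b → (a ≡ true → b ≡ true) → a ∨ (b ∧ not a) ≡ b
          absorb true  b a⇒b = ≡.sym (a⇒b refl)
          absorb false b _   = Bool.∧-identityʳ b
        separates : ∀ a b → lookup S a ≡ true → lookup S b ≡ true → adj G a b ≡ true → lookup c a ≢ lookup c b
        separates a b Sa Sb ab ca≡cb with lookup U a in Ua
        ... | true  = separates₁ a b Ua Ub ab c₁a≡c₁b
          where
          c₁a≡c₁b = trans (≡.sym (red-c a)) (trans (cong red ca≡cb) (red-c b))
          Ub = trans (support₁ b) (trans (cong isJust (≡.sym c₁a≡c₁b)) (trans (≡.sym (support₁ a)) Ua))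
        ... | false = separates₂ a b Da Db ab c₂a≡c₂b
          where
          c₂a≡c₂b = trans (≡.sym (blue-c a)) (trans (cong blue ca≡cb) (blue-c b))
          Da = trans (lookup-─ S U a) (cong₂ (λ s t → s ∧ not t) Sa Ua)
          Db = trans (support₂ b) (trans (cong isJust (≡.sym c₂a≡c₂b)) (trans (≡.sym (support₂ a)) Da))

      red-u : isRed (lookup c u) ≡ true
      red-u = trans (cong isJust (red-c u)) (trans (≡.sym (support₁ u)) U-u)

      blue-v : isBlue (lookup c v) ≡ true
      blue-v = trans (cong isJust (blue-c v))
                 (trans (≡.sym (support₂ v)) (trans (lookup-─ S U v) (cong₂ (λ s t → s ∧ not t) Sv U-v)))

  glue-proper : ∀ b → SplitProper b ≡ true → RedBlueProper (glue b) ≡ true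
  glue-proper (U , c₁ , c₂) splitProper =
    ∧-true⁺ (IsProper⇒isProperColouring G S c proper) (∧-true⁺ red-u blue-v)
    where open Glued U c₁ c₂ splitProper

  split∘glue : ∀ b → SplitProper b ≡ true → split (glue b) ≡ b
  split∘glue (U , c₁ , c₂) splitProper =
    cong₂ _,_ (lookup-≗⇒≡ λ w → trans (Vec.lookup-map w isRed c) (trans (cong isJust (red-c w)) (≡.sym (support₁ w))))
              (cong₂ _,_ (lookup-≗⇒≡ λ w → trans (Vec.lookup-map w red c) (red-c w))
                         (lookup-≗⇒≡ λ w → trans (Vec.lookup-map w blue c) (blue-c w)))
    where open Glued U c₁ c₂ splitProper

  redBlue-count : countB RedBlueProper (colourings (x + y) N)
    ≡ ∑[ U ∈ allSubsets N ] (ind (Separates S u v U) * (numColourings G U x * numColourings G (S ─ U) y))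
  redBlue-count = begin
    countB RedBlueProper (colourings (x + y) N)
      ≡⟨ countB-bijection (colourings-enumerates (x + y) N)
           (pairs-enumerates (allSubsets-enumerates N)
             (pairs-enumerates (colourings-enumerates x N) (colourings-enumerates y N)))
           RedBlueProper SplitProper split glue split-proper glue-proper (λ c _ → glue∘split c) split∘glue ⟩
    countB SplitProper (pairs (allSubsets N) colouringPairs)
      ≡⟨ countB≡∑ SplitProper (pairs (allSubsets N) colouringPairs) ⟩
    ∑ (pairs (allSubsets N) colouringPairs) (ind ∘ SplitProper)
      ≡⟨ ∑-pairs (allSubsets N) colouringPairs (ind ∘ SplitProper) ⟩
    ∑[ U ∈ allSubsets N ] ∑[ cc ∈ colouringPairs ] ind (SplitProper (U , cc))
      ≡⟨ ∑-cong (allSubsets N) fixedU ⟩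
    ∑[ U ∈ allSubsets N ] (ind (Separates S u v U) * (numColourings G U x * numColourings G (S ─ U) y))
      ∎
    where
    colouringPairs = pairs (colourings x N) (colourings y N)
    fixedU : ∀ U → ∑[ cc ∈ colouringPairs ] ind (SplitProper (U , cc))
                   ≡ ind (Separates S u v U) * (numColourings G U x * numColourings G (S ─ U) y)
    fixedU U = begin
      ∑[ cc ∈ colouringPairs ] ind (SplitProper (U , cc))
        ≡⟨ ∑-pairs (colourings x N) (colourings y N) _ ⟩
      ∑[ c₁ ∈ colourings x N ] ∑[ c₂ ∈ colourings y N ] ind (Separates S u v U ∧ (P₁ c₁ ∧ P₂ c₂))
        ≡⟨ ∑-cong (colourings x N) (λ c₁ → ∑-cong (colourings y N) λ c₂ →
             trans (ind-∧ (Separates S u v U) _) (cong (ind (Separates S u v U) *_) (ind-∧ (P₁ c₁) (P₂ c₂)))) ⟩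
      ∑[ c₁ ∈ colourings x N ] ∑[ c₂ ∈ colourings y N ] (ind (Separates S u v U) * (ind (P₁ c₁) * ind (P₂ c₂)))
        ≡⟨ ∑-cong (colourings x N) (λ c₁ → ∑-*ˡ (colourings y N) (ind (Separates S u v U)) _) ⟩
      ∑[ c₁ ∈ colourings x N ] (ind (Separates S u v U) * ∑[ c₂ ∈ colourings y N ] (ind (P₁ c₁) * ind (P₂ c₂)))
        ≡⟨ ∑-*ˡ (colourings x N) (ind (Separates S u v U)) _ ⟩
      ind (Separates S u v U) * ∑[ c₁ ∈ colourings x N ] ∑[ c₂ ∈ colourings y N ] (ind (P₁ c₁) * ind (P₂ c₂))
        ≡⟨ cong (ind (Separates S u v U) *_) (∑-product (colourings x N) (colourings y N) (ind ∘ P₁) (ind ∘ P₂)) ⟩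
      ind (Separates S u v U) * (∑ (colourings x N) (ind ∘ P₁) * ∑ (colourings y N) (ind ∘ P₂))
        ≡⟨ cong (ind (Separates S u v U) *_) (cong₂ _*_ (countB≡∑ P₁ (colourings x N)) (countB≡∑ P₂ (colourings y N))) ⟨
      ind (Separates S u v U) * (numColourings G U x * numColourings G (S ─ U) y)
        ∎
      where
      P₁ = isProperColouring G U
      P₂ = isProperColouring G (S ─ U)

-- Permuting the colours

module _ {q : ℕ} (i j : Fin q) where

  transpose-left : transpose i j ⟨$⟩ʳ i ≡ j
  transpose-left rewrite dec-true (i Fin.≟ i) refl = refl

  transpose-fixes : ∀ {k} → k ≢ i → k ≢ j → transpose i j ⟨$⟩ʳ k ≡ k
  transpose-fixes {k} k≢i k≢j rewrite dec-false (k Fin.≟ i) k≢i | dec-false (k Fin.≟ j) k≢j = refl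

does⇒ : {A : Set} (d : Dec A) → does d ≡ true → A
does⇒ (yes a) _ = a

ind-∧-∧ : ∀ p r t → ind ((p ∧ r) ∧ t) ≡ ind r * ind (p ∧ t)
ind-∧-∧ true  true  t = ≡.sym (ℕ.+-identityʳ (ind t))
ind-∧-∧ true  false t = refl
ind-∧-∧ false true  t = refl
ind-∧-∧ false false t = refl

_≟ᵖ_ : ∀ {q} → DecidableEquality (Maybe (Fin q) × Maybe (Fin q))
_≟ᵖ_ = ×-≡-dec _≟ᶜ_ _≟ᶜ_

∑-colourOptions : ∀ q (f : Maybe (Fin q) → ℕ) → f nothing ≡ 0 → ∑ (colourOptions q) f ≡ ∑[ i ∈ allFin q ] f (just i)
∑-colourOptions q f f-nothing = trans (cong (_+ ∑ (map just (allFin q)) f) f-nothing) (∑-map just (allFin q) f)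

module PinnedColours (G : Graph) (S : Subset (n G)) (u v : Fin (n G)) (q : ℕ) where

  private
    N = n G

  ends : Vec (Maybe (Fin q)) N → Maybe (Fin q) × Maybe (Fin q)
  ends c = lookup c u , lookup c v

  Pinned : Maybe (Fin q) → Maybe (Fin q) → Vec (Maybe (Fin q)) N → Bool
  Pinned a b c = isProperColouring G S c ∧ does (ends c ≟ᵖ (a , b))

  pinned : Maybe (Fin q) → Maybe (Fin q) → ℕ
  pinned a b = countB (Pinned a b) (colourings q N)

  countB-by-ends : (R : Maybe (Fin q) → Maybe (Fin q) → Bool) →
    countB (λ c → isProperColouring G S c ∧ R (lookup c u) (lookup c v)) (colourings q N)
      ≡ ∑[ a ∈ colourOptions q ] ∑[ b ∈ colourOptions q ] (ind (R a b) * pinned a b)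
  countB-by-ends R = begin
    countB P (colourings q N)
      ≡⟨ countB-partition _≟ᵖ_ endsList
           (pairs-enumerates (colourOptions-enumerates q) (colourOptions-enumerates q)) ends P (colourings q N) ⟩
    ∑[ ab ∈ endsList ] countB (λ c → P c ∧ does (ends c ≟ᵖ ab)) (colourings q N)
      ≡⟨ ∑-cong endsList fibre ⟩
    ∑[ ab ∈ endsList ] (ind (R (proj₁ ab) (proj₂ ab)) * pinned (proj₁ ab) (proj₂ ab))
      ≡⟨ ∑-pairs (colourOptions q) (colourOptions q) _ ⟩
    ∑[ a ∈ colourOptions q ] ∑[ b ∈ colourOptions q ] (ind (R a b) * pinned a b)
      ∎
    where
    endsList = pairs (colourOptions q) (colourOptions q)
    P : Vec (Maybe (Fin q)) N → Bool
    P c = isProperColouring G S c ∧ R (lookup c u) (lookup c v)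
    atEnds : ∀ a b c → ind (P c ∧ does (ends c ≟ᵖ (a , b))) ≡ ind (R a b) * ind (Pinned a b c)
    atEnds a b c = regroup (ends c ≟ᵖ (a , b))
      where
      p = isProperColouring G S c
      regroup : (d : Dec (ends c ≡ (a , b))) → ind ((p ∧ R (lookup c u) (lookup c v)) ∧ does d) ≡ ind (R a b) * ind (p ∧ does d)
      regroup (yes ends≡ab) = trans (ind-∧-∧ p _ true)
                                (cong (λ r → ind r * ind (p ∧ true)) (cong₂ R (cong proj₁ ends≡ab) (cong proj₂ ends≡ab)))
      regroup (no _) = begin
        ind ((p ∧ R (lookup c u) (lookup c v)) ∧ false) ≡⟨ cong ind (Bool.∧-zeroʳ _) ⟩
        0                                               ≡⟨ ℕ.*-zeroʳ (ind (R a b)) ⟨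
        ind (R a b) * 0                                 ≡⟨ cong (λ t → ind (R a b) * ind t) (Bool.∧-zeroʳ p) ⟨
        ind (R a b) * ind (p ∧ false)                   ∎
    fibre : ∀ ab → countB (λ c → P c ∧ does (ends c ≟ᵖ ab)) (colourings q N)
                   ≡ ind (R (proj₁ ab) (proj₂ ab)) * pinned (proj₁ ab) (proj₂ ab)
    fibre (a , b) = begin
      countB (λ c → P c ∧ does (ends c ≟ᵖ (a , b))) (colourings q N)
        ≡⟨ countB≡∑ _ (colourings q N) ⟩
      ∑[ c ∈ colourings q N ] ind (P c ∧ does (ends c ≟ᵖ (a , b)))
        ≡⟨ ∑-cong (colourings q N) (atEnds a b) ⟩
      ∑[ c ∈ colourings q N ] (ind (R a b) * ind (Pinned a b c))
        ≡⟨ ∑-*ˡ (colourings q N) (ind (R a b)) _ ⟩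
      ind (R a b) * ∑[ c ∈ colourings q N ] ind (Pinned a b c)
        ≡⟨ cong (ind (R a b) *_) (countB≡∑ (Pinned a b) (colourings q N)) ⟨
      ind (R a b) * pinned a b
        ∎

  Pinned⇒ : ∀ a b c → Pinned a b c ≡ true → IsProper G S c × ends c ≡ (a , b)
  Pinned⇒ a b c pin = isProperColouring⇒IsProper G S c (Bool.∧-conicalˡ _ _ pin)
                    , does⇒ (ends c ≟ᵖ (a , b)) (Bool.∧-conicalʳ (isProperColouring G S c) _ pin)

  pinned-zero : ∀ a b → (∀ c → IsProper G S c → ends c ≢ (a , b)) → pinned a b ≡ 0
  pinned-zero a b impossible = trans (countB≡∑ (Pinned a b) (colourings q N))
    (∑-zero (colourings q N) _ λ c → cong ind (Bool.¬-not λ pin →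
      impossible c (proj₁ (Pinned⇒ a b c pin)) (proj₂ (Pinned⇒ a b c pin))))

  pinned-nothingˡ : lookup S u ≡ true → ∀ b → pinned nothing b ≡ 0
  pinned-nothingˡ Su b = pinned-zero nothing b λ c proper ends≡ →
    contradiction (trans (≡.sym Su) (trans (IsProper.support proper u) (cong (isJust ∘ proj₁) ends≡))) λ ()

  pinned-nothingʳ : lookup S v ≡ true → ∀ a → pinned a nothing ≡ 0
  pinned-nothingʳ Sv a = pinned-zero a nothing λ c proper ends≡ →
    contradiction (trans (≡.sym Sv) (trans (IsProper.support proper v) (cong (isJust ∘ proj₂) ends≡))) λ ()

  pinned-diagonal : lookup S u ≡ true → lookup S v ≡ true → adj G u v ≡ true → ∀ i → pinned (just i) (just i) ≡ 0
  pinned-diagonal Su Sv uv i = pinned-zero (just i) (just i) λ c proper ends≡ →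
    IsProper.separates proper u v Su Sv uv (trans (cong proj₁ ends≡) (≡.sym (cong proj₂ ends≡)))

  recolour : Permutation′ q → Vec (Maybe (Fin q)) N → Vec (Maybe (Fin q)) N
  recolour π = Vec.map (Maybe.map (π ⟨$⟩ʳ_))

  private
    isJust-map : ∀ (π : Permutation′ q) m → isJust (Maybe.map (π ⟨$⟩ʳ_) m) ≡ isJust m
    isJust-map π (just _) = refl
    isJust-map π nothing  = refl

    map-inverse : ∀ (π : Permutation′ q) m → Maybe.map (π ⟨$⟩ˡ_) (Maybe.map (π ⟨$⟩ʳ_) m) ≡ m
    map-inverse π (just i) = cong just (inverseˡ π)
    map-inverse π nothing  = refl

  recolour-IsProper : ∀ π c → IsProper G S c → IsProper G S (recolour π c)
  recolour-IsProper π c proper = record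
    { support   = λ w → trans (support w) (trans (≡.sym (isJust-map π (lookup c w)))
                                                 (cong isJust (≡.sym (Vec.lookup-map w _ c))))
    ; separates = λ a b Sa Sb ab πca≡πcb → separates a b Sa Sb ab
        (Maybe.map-injective (Injection.injective (↔⇒↣ π))
          (trans (≡.sym (Vec.lookup-map a _ c)) (trans πca≡πcb (Vec.lookup-map b _ c))))
    }
    where open IsProper proper

  recolour-Pinned : ∀ π a b c → Pinned a b c ≡ true →
    Pinned (Maybe.map (π ⟨$⟩ʳ_) a) (Maybe.map (π ⟨$⟩ʳ_) b) (recolour π c) ≡ true
  recolour-Pinned π a b c pin =
    ∧-true⁺ (IsProper⇒isProperColouring G S (recolour π c) (recolour-IsProper π c proper))
            (dec-true (ends (recolour π c) ≟ᵖ _)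
              (cong₂ _,_ (trans (Vec.lookup-map u _ c) (cong (Maybe.map (π ⟨$⟩ʳ_) ∘ proj₁) ends≡))
                         (trans (Vec.lookup-map v _ c) (cong (Maybe.map (π ⟨$⟩ʳ_) ∘ proj₂) ends≡))))
    where
    proper = proj₁ (Pinned⇒ a b c pin)
    ends≡ = proj₂ (Pinned⇒ a b c pin)

  recolour-inverse : ∀ π c → recolour (flip π) (recolour π c) ≡ c
  recolour-inverse π c = lookup-≗⇒≡ λ w → begin
    lookup (recolour (flip π) (recolour π c)) w             ≡⟨ Vec.lookup-map w _ (recolour π c) ⟩
    Maybe.map (π ⟨$⟩ˡ_) (lookup (recolour π c) w)           ≡⟨ cong (Maybe.map (π ⟨$⟩ˡ_)) (Vec.lookup-map w _ c) ⟩
    Maybe.map (π ⟨$⟩ˡ_) (Maybe.map (π ⟨$⟩ʳ_) (lookup c w))  ≡⟨ map-inverse π (lookup c w) ⟩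
    lookup c w                                              ∎

  pinned-permute : ∀ (π : Permutation′ q) a b → pinned a b ≡ pinned (Maybe.map (π ⟨$⟩ʳ_) a) (Maybe.map (π ⟨$⟩ʳ_) b)
  pinned-permute π a b = countB-bijection (colourings-enumerates q N) (colourings-enumerates q N)
    (Pinned a b) (Pinned (Maybe.map (π ⟨$⟩ʳ_) a) (Maybe.map (π ⟨$⟩ʳ_) b)) (recolour π) (recolour (flip π))
    (recolour-Pinned π a b)
    (λ c pin → subst₂ (λ a′ b′ → Pinned a′ b′ (recolour (flip π) c) ≡ true) (map-inverse π a) (map-inverse π b)
                  (recolour-Pinned (flip π) _ _ c pin))
    (λ c _ → recolour-inverse π c)
    (λ c _ → recolour-inverse (flip π) c)

  pinned-constant : ∀ {i j a b} → i ≢ j → a ≢ b → pinned (just i) (just j) ≡ pinned (just a) (just b)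
  pinned-constant {i} {j} {a} {b} i≢j a≢b = begin
    pinned (just i) (just j)         ≡⟨ pinned-permute τ₁ (just i) (just j) ⟩
    pinned (just (τ₁ ⟨$⟩ʳ i)) (just j′) ≡⟨ cong (λ k → pinned (just k) (just j′)) (transpose-left i a) ⟩
    pinned (just a) (just j′)        ≡⟨ pinned-permute τ₂ (just a) (just j′) ⟩
    pinned (just (τ₂ ⟨$⟩ʳ a)) (just (τ₂ ⟨$⟩ʳ j′))
      ≡⟨ cong₂ (λ k l → pinned (just k) (just l)) (transpose-fixes j′ b a≢j′ a≢b) (transpose-left j′ b) ⟩
    pinned (just a) (just b)         ∎
    where
    τ₁ = transpose i a
    j′ = τ₁ ⟨$⟩ʳ j
    τ₂ = transpose j′ b
    a≢j′ : a ≢ j′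
    a≢j′ a≡j′ = i≢j (Injection.injective (↔⇒↣ τ₁) (trans (transpose-left i a) a≡j′))

∑-allFin-const : ∀ q c → ∑[ i ∈ allFin q ] c ≡ q * c
∑-allFin-const q c = trans (∑-const (allFin q) c) (cong (_* c) (length-tabulate {n = q} id))

∑-allFin-≢ : ∀ q (a : Fin q) → ∑[ b ∈ allFin q ] ind (not (does (b Fin.≟ a))) ≡ q ∸ 1
∑-allFin-≢ q a = begin
  others                                          ≡⟨ ℕ.m+n∸m≡n 1 others ⟨
  1 + others ∸ 1                                  ≡⟨ cong (λ t → t + others ∸ 1) (occursOnce (allFin-enumerates q) a) ⟨
  multiplicity Fin._≟_ (allFin q) a + others ∸ 1  ≡⟨ cong (_∸ 1) (∑-distrib-+ (allFin q) same differ) ⟨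
  ∑[ b ∈ allFin q ] (same b + differ b) ∸ 1       ≡⟨ cong (_∸ 1) (∑-cong (allFin q) (λ b → ind-+-ind-not (does (b Fin.≟ a)))) ⟩
  ∑[ b ∈ allFin q ] 1 ∸ 1                         ≡⟨ cong (_∸ 1) (∑-allFin-const q 1) ⟩
  q * 1 ∸ 1                                       ≡⟨ cong (_∸ 1) (ℕ.*-identityʳ q) ⟩
  q ∸ 1                                           ∎
  where
  same differ : Fin q → ℕ
  same   b = ind (does (b Fin.≟ a))
  differ b = ind (not (does (b Fin.≟ a)))
  others = ∑ (allFin q) differ
  ind-+-ind-not : ∀ b → ind b + ind (not b) ≡ 1
  ind-+-ind-not true  = refl
  ind-+-ind-not false = refl

∑-allFin-+ : ∀ x y (f : Fin (x + y) → ℕ) →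
  ∑ (allFin (x + y)) f ≡ ∑[ i ∈ allFin x ] f (i ↑ˡ y) + ∑[ j ∈ allFin y ] f (x ↑ʳ j)
∑-allFin-+ zero    y f = refl
∑-allFin-+ (suc x) y f = begin
  ∑ (allFin (suc x + y)) f
    ≡⟨ ∑-allFin-suc (x + y) f ⟩
  f zero + ∑[ k ∈ allFin (x + y) ] f (suc k)
    ≡⟨ cong (f zero +_) (∑-allFin-+ x y (f ∘ suc)) ⟩
  f zero + (∑[ i ∈ allFin x ] f (suc (i ↑ˡ y)) + ∑[ j ∈ allFin y ] f (suc x ↑ʳ j))
    ≡⟨ ℕ.+-assoc (f zero) _ _ ⟨
  f zero + ∑[ i ∈ allFin x ] f (suc (i ↑ˡ y)) + ∑[ j ∈ allFin y ] f (suc x ↑ʳ j)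
    ≡⟨ cong (_+ ∑[ j ∈ allFin y ] f (suc x ↑ʳ j)) (∑-allFin-suc x (λ i → f (i ↑ˡ y))) ⟨
  ∑[ i ∈ allFin (suc x) ] f (i ↑ˡ y) + ∑[ j ∈ allFin y ] f (suc x ↑ʳ j)
    ∎

module _ (x y : ℕ) where
  open RedBlue x y

  ∑-isRed : ∑[ k ∈ allFin (x + y) ] ind (isRed (just k)) ≡ x
  ∑-isRed = begin
    ∑[ k ∈ allFin (x + y) ] ind (isRed (just k))
      ≡⟨ ∑-allFin-+ x y _ ⟩
    ∑[ i ∈ allFin x ] ind (isRed (just (i ↑ˡ y))) + ∑[ j ∈ allFin y ] ind (isRed (just (x ↑ʳ j)))
      ≡⟨ cong₂ _+_ (∑-cong (allFin x) (λ i → cong (ind ∘ isJust ∘ [ just , const nothing ]′) (Fin.splitAt-↑ˡ x i y)))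
                   (∑-zero (allFin y) _ (λ j → cong (ind ∘ isJust ∘ [ just , const nothing ]′) (Fin.splitAt-↑ʳ x y j))) ⟩
    ∑[ i ∈ allFin x ] 1 + 0
      ≡⟨ trans (ℕ.+-identityʳ _) (trans (∑-allFin-const x 1) (ℕ.*-identityʳ x)) ⟩
    x
      ∎

  ∑-isBlue : ∑[ k ∈ allFin (x + y) ] ind (isBlue (just k)) ≡ y
  ∑-isBlue = begin
    ∑[ k ∈ allFin (x + y) ] ind (isBlue (just k))
      ≡⟨ ∑-allFin-+ x y _ ⟩
    ∑[ i ∈ allFin x ] ind (isBlue (just (i ↑ˡ y))) + ∑[ j ∈ allFin y ] ind (isBlue (just (x ↑ʳ j)))
      ≡⟨ cong₂ _+_ (∑-zero (allFin x) _ (λ i → cong (ind ∘ isJust ∘ [ const nothing , just ]′) (Fin.splitAt-↑ˡ x i y)))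
                   (∑-cong (allFin y) (λ j → cong (ind ∘ isJust ∘ [ const nothing , just ]′) (Fin.splitAt-↑ʳ x y j))) ⟩
    ∑[ j ∈ allFin y ] 1
      ≡⟨ trans (∑-allFin-const y 1) (ℕ.*-identityʳ y) ⟩
    y
      ∎

module EdgeColourings (G : Graph) (S : Subset (n G)) (u v : Fin (n G))
                      (Su : lookup S u ≡ true) (Sv : lookup S v ≡ true) (uv : adj G u v ≡ true) where

  private
    N = n G

  module _ (q : ℕ) where
    open PinnedColours G S u v q

    pinnedAt : Fin q → Fin q → ℕ
    pinnedAt i j = pinned (just i) (just j)

    countB-by-coloured-ends : (R : Maybe (Fin q) → Maybe (Fin q) → Bool) →
      countB (λ c → isProperColouring G S c ∧ R (lookup c u) (lookup c v)) (colourings q N)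
        ≡ ∑[ i ∈ allFin q ] ∑[ j ∈ allFin q ] (ind (R (just i) (just j)) * pinnedAt i j)
    countB-by-coloured-ends R = begin
      countB (λ c → isProperColouring G S c ∧ R (lookup c u) (lookup c v)) (colourings q N)
        ≡⟨ countB-by-ends R ⟩
      ∑[ a ∈ colourOptions q ] ∑[ b ∈ colourOptions q ] (ind (R a b) * pinned a b)
        ≡⟨ ∑-colourOptions q _ (∑-zero (colourOptions q) _ λ b →
             trans (cong (ind (R nothing b) *_) (pinned-nothingˡ Su b)) (ℕ.*-zeroʳ (ind (R nothing b)))) ⟩
      ∑[ i ∈ allFin q ] ∑[ b ∈ colourOptions q ] (ind (R (just i) b) * pinned (just i) b)
        ≡⟨ ∑-cong (allFin q) (λ i → ∑-colourOptions q _
             (trans (cong (ind (R (just i) nothing) *_) (pinned-nothingʳ Sv (just i))) (ℕ.*-zeroʳ (ind (R (just i) nothing))))) ⟩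
      ∑[ i ∈ allFin q ] ∑[ j ∈ allFin q ] (ind (R (just i) (just j)) * pinnedAt i j)
        ∎

    numColourings-by-ends : numColourings G S q ≡ ∑[ i ∈ allFin q ] ∑[ j ∈ allFin q ] pinnedAt i j
    numColourings-by-ends = begin
      numColourings G S q
        ≡⟨ countB-cong (λ c → ≡.sym (Bool.∧-identityʳ (isProperColouring G S c))) (colourings q N) ⟩
      countB (λ c → isProperColouring G S c ∧ true) (colourings q N)
        ≡⟨ countB-by-coloured-ends (λ _ _ → true) ⟩
      ∑[ i ∈ allFin q ] ∑[ j ∈ allFin q ] (1 * pinnedAt i j)
        ≡⟨ ∑-cong (allFin q) (λ i → ∑-cong (allFin q) (λ j → ℕ.*-identityˡ (pinnedAt i j))) ⟩
      ∑[ i ∈ allFin q ] ∑[ j ∈ allFin q ] pinnedAt i j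
        ∎

    numColourings-by-pinned : ∀ {i₀ j₀ : Fin q} → i₀ ≢ j₀ → numColourings G S q ≡ q * ((q ∸ 1) * pinnedAt i₀ j₀)
    numColourings-by-pinned {i₀} {j₀} i₀≢j₀ = begin
      numColourings G S q
        ≡⟨ numColourings-by-ends ⟩
      ∑[ i ∈ allFin q ] ∑[ j ∈ allFin q ] pinnedAt i j
        ≡⟨ ∑-cong (allFin q) (λ i → ∑-cong (allFin q) (offDiagonal i)) ⟩
      ∑[ i ∈ allFin q ] ∑[ j ∈ allFin q ] (ind (not (does (j Fin.≟ i))) * pinnedAt i₀ j₀)
        ≡⟨ ∑-cong (allFin q) (λ i → trans (∑-*ʳ (allFin q) _ _) (cong (_* pinnedAt i₀ j₀) (∑-allFin-≢ q i))) ⟩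
      ∑[ i ∈ allFin q ] ((q ∸ 1) * pinnedAt i₀ j₀)
        ≡⟨ ∑-allFin-const q _ ⟩
      q * ((q ∸ 1) * pinnedAt i₀ j₀)
        ∎
      where
      offDiagonal : ∀ i j → pinnedAt i j ≡ ind (not (does (j Fin.≟ i))) * pinnedAt i₀ j₀
      offDiagonal i j with j Fin.≟ i
      ... | yes refl = pinned-diagonal Su Sv uv j
      ... | no  j≢i  = trans (pinned-constant (j≢i ∘ ≡.sym) i₀≢j₀) (≡.sym (ℕ.+-identityʳ _))

  numColourings-one : numColourings G S 1 ≡ 0
  numColourings-one = trans (numColourings-by-ends 1)
    (cong (λ t → t + 0 + 0) (PinnedColours.pinned-diagonal G S u v 1 Su Sv uv zero))

-- The edge identity

module EdgeIdentity (G : Graph) (cp : Subset (n G) → Poly) (hcp : ∀ S → IsChromaticPolynomial G S (cp S))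
                    (S : Subset (n G)) (u v : Fin (n G))
                    (Su : lookup S u ≡ true) (Sv : lookup S v ≡ true) (uv : adj G u v ≡ true) where
  open import Data.Integer using (+_; -_; _-_)
  open EdgeColourings G S u v Su Sv uv

  private
    N = n G

  χ-roots : Σ[ Q ∈ Poly ] (∀ z → eval (cp S) z ≡ z ℤ.* ((z - + 1) ℤ.* eval Q z)) × (coeff (cp S) 1 ≡ - eval Q (+ 0))
  χ-roots = factor-x[x-1] (cp S)
    (trans (hcp S 0) (cong (λ k → + k) (numColourings-zero-nonempty G S u Su)))
    (trans (hcp S 1) (cong (λ k → + k) numColourings-one))

  Q : Poly
  Q = proj₁ χ-roots

  pinned-value : ∀ q {i j : Fin q} → i ≢ j → + pinnedAt q i j ≡ eval Q (+ q)
  pinned-value (suc zero)    {zero} {zero} i≢j = contradiction refl i≢j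
  pinned-value (suc (suc r)) {i}    {j}    i≢j =
    ℤₚ.*-cancelˡ-≡ (+ suc r) _ _ (ℤₚ.*-cancelˡ-≡ (+ q) _ _ (begin
      + q ℤ.* (+ suc r ℤ.* + pinnedAt q i j)  ≡⟨ cong (+ q ℤ.*_) (ℤₚ.pos-* (suc r) (pinnedAt q i j)) ⟨
      + q ℤ.* + (suc r * pinnedAt q i j)      ≡⟨ ℤₚ.pos-* q (suc r * pinnedAt q i j) ⟨
      + (q * (suc r * pinnedAt q i j))        ≡⟨ cong (λ k → + k) (numColourings-by-pinned q i≢j) ⟨
      + numColourings G S q                   ≡⟨ hcp S q ⟨
      eval (cp S) (+ q)                       ≡⟨ proj₁ (proj₂ χ-roots) (+ q) ⟩
      + q ℤ.* (+ suc r ℤ.* eval Q (+ q))      ∎))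
    where q = suc (suc r)

  redBlue-value : ∀ x y → + countB (Splitting.RedBlueProper G S u v Sv x y) (colourings (x + y) N)
                          ≡ + x ℤ.* (+ y ℤ.* eval Q (+ (x + y)))
  redBlue-value x y = begin
    + countB (λ c → isProperColouring G S c ∧ (isRed (lookup c u) ∧ isBlue (lookup c v))) (colourings (x + y) N)
      ≡⟨ cong (λ k → + k) (countB-by-coloured-ends (x + y) (λ a b → isRed a ∧ isBlue b)) ⟩
    + ∑[ k ∈ allFin (x + y) ] ∑[ l ∈ allFin (x + y) ] (ind (isRed (just k) ∧ isBlue (just l)) * pinnedAt (x + y) k l)
      ≡⟨ +-∑∑-separable (allFin (x + y)) (allFin (x + y)) (isRed ∘ just) (isBlue ∘ just) (pinnedAt (x + y))
                         (eval Q (+ (x + y))) red-blue-value ⟩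
    + ∑ (allFin (x + y)) (ind ∘ isRed ∘ just) ℤ.* (+ ∑ (allFin (x + y)) (ind ∘ isBlue ∘ just) ℤ.* eval Q (+ (x + y)))
      ≡⟨ cong₂ (λ s t → + s ℤ.* (+ t ℤ.* eval Q (+ (x + y)))) (∑-isRed x y) (∑-isBlue x y) ⟩
    + x ℤ.* (+ y ℤ.* eval Q (+ (x + y)))
      ∎
    where
    open RedBlue x y
    red-blue-value : ∀ k l → isRed (just k) ≡ true → isBlue (just l) ≡ true → + pinnedAt (x + y) k l ≡ eval Q (+ (x + y))
    red-blue-value k l red-k blue-l = pinned-value (x + y) λ k≡l →
      contradiction (trans (≡.sym red-k) (trans (cong (isRed ∘ just) k≡l) (isBlue⇒¬isRed (just l) blue-l))) λ ()

  edge-identity : ∑ℤ[ U ∈ allSubsets N ] (+ ind (Separates S u v U) ℤ.* (coeff (cp U) 1 ℤ.* coeff (cp (S ─ U)) 1))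
                  ≡ - coeff (cp S) 1
  edge-identity = begin
    ∑ℤ[ U ∈ allSubsets N ] (+ ind (Separates S u v U) ℤ.* (coeff (cp U) 1 ℤ.* coeff (cp (S ─ U)) 1))
      ≡⟨ xy-coefficient (allSubsets N) (λ U → + ind (Separates S u v U)) cp (λ U → cp (S ─ U)) Q counting ⟩
    coeff Q 0          ≡⟨ coeff₀≡eval₀ Q ⟩
    eval Q (+ 0)       ≡⟨ ℤₚ.neg-involutive _ ⟨
    - - eval Q (+ 0)   ≡⟨ cong -_ (proj₂ (proj₂ χ-roots)) ⟨
    - coeff (cp S) 1   ∎
    where
    counting : ∀ x y → ∑ℤ[ U ∈ allSubsets N ] (+ ind (Separates S u v U) ℤ.* (eval (cp U) (+ x) ℤ.* eval (cp (S ─ U)) (+ y)))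
                       ≡ + x ℤ.* (+ y ℤ.* eval Q (+ x ℤ.+ + y))
    counting x y = begin
      ∑ℤ[ U ∈ allSubsets N ] (+ ind (Separates S u v U) ℤ.* (eval (cp U) (+ x) ℤ.* eval (cp (S ─ U)) (+ y)))
        ≡⟨ ∑ℤ-cong (allSubsets N) (λ U → ≡.sym (begin
             + (ind (Separates S u v U) * (numColourings G U x * numColourings G (S ─ U) y))
               ≡⟨ ℤₚ.pos-* (ind (Separates S u v U)) _ ⟩
             + ind (Separates S u v U) ℤ.* + (numColourings G U x * numColourings G (S ─ U) y)
               ≡⟨ cong (+ ind (Separates S u v U) ℤ.*_) (ℤₚ.pos-* (numColourings G U x) _) ⟩
             + ind (Separates S u v U) ℤ.* (+ numColourings G U x ℤ.* + numColourings G (S ─ U) y)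
               ≡⟨ cong₂ (λ s t → + ind (Separates S u v U) ℤ.* (s ℤ.* t)) (hcp U x) (hcp (S ─ U) y) ⟨
             + ind (Separates S u v U) ℤ.* (eval (cp U) (+ x) ℤ.* eval (cp (S ─ U)) (+ y))
               ∎)) ⟩
      ∑ℤ[ U ∈ allSubsets N ] (+ (ind (Separates S u v U) * (numColourings G U x * numColourings G (S ─ U) y)))
        ≡⟨ +-∑ (allSubsets N) _ ⟨
      + ∑[ U ∈ allSubsets N ] (ind (Separates S u v U) * (numColourings G U x * numColourings G (S ─ U) y))
        ≡⟨ cong (λ k → + k) (Splitting.redBlue-count G S u v Sv x y) ⟨
      + countB (Splitting.RedBlueProper G S u v Sv x y) (colourings (x + y) N)
        ≡⟨ redBlue-value x y ⟩
      + x ℤ.* (+ y ℤ.* eval Q (+ (x + y)))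
        ≡⟨ cong (λ t → + x ℤ.* (+ y ℤ.* eval Q t)) (ℤₚ.pos-+ x y) ⟩
      + x ℤ.* (+ y ℤ.* eval Q (+ x ℤ.+ + y))
        ∎

-- Isolated vertices

lookup-⁅⁆ : ∀ {k} (w w′ : Fin k) → lookup ⁅ w ⁆ w′ ≡ does (w′ Fin.≟ w)
lookup-⁅⁆ zero    zero     = refl
lookup-⁅⁆ zero    (suc w′) = Vec.lookup-replicate w′ false
lookup-⁅⁆ (suc w) zero     = refl
lookup-⁅⁆ (suc w) (suc w′) = lookup-⁅⁆ w w′

lookup-remove : ∀ {k} (T : Subset k) (w w′ : Fin k) → lookup (T ─ ⁅ w ⁆) w′ ≡ lookup T w′ ∧ not (does (w′ Fin.≟ w))
lookup-remove T w w′ = trans (lookup-─ T ⁅ w ⁆ w′) (cong (λ t → lookup T w′ ∧ not t) (lookup-⁅⁆ w w′))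

module IsolatedVertex (G : Graph) (T : Subset (n G)) (w : Fin (n G)) (Tw : lookup T w ≡ true)
                      (isolated : ∀ w′ → lookup T w′ ≡ true → adj G w w′ ≡ false) (q : ℕ) where

  private
    N = n G

  Detached : Maybe (Fin q) × Vec (Maybe (Fin q)) N → Bool
  Detached (m , c′) = isJust m ∧ isProperColouring G (T ─ ⁅ w ⁆) c′

  detach : Vec (Maybe (Fin q)) N → Maybe (Fin q) × Vec (Maybe (Fin q)) N
  detach c = lookup c w , c [ w ]≔ nothing

  attach : Maybe (Fin q) × Vec (Maybe (Fin q)) N → Vec (Maybe (Fin q)) N
  attach (m , c′) = c′ [ w ]≔ m

  private
    removed : lookup (T ─ ⁅ w ⁆) w ≡ false
    removed = trans (lookup-remove T w w)
                (trans (cong (λ t → lookup T w ∧ not t) (dec-true (w Fin.≟ w) refl)) (Bool.∧-zeroʳ _))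

    kept : ∀ {w′} → w′ ≢ w → lookup (T ─ ⁅ w ⁆) w′ ≡ lookup T w′
    kept {w′} w′≢w = trans (lookup-remove T w w′)
                       (trans (cong (λ t → lookup T w′ ∧ not t) (dec-false (w′ Fin.≟ w) w′≢w)) (Bool.∧-identityʳ _))

    ≢w : ∀ {w′} → lookup (T ─ ⁅ w ⁆) w′ ≡ true → w′ ≢ w
    ≢w T-w-w′ refl = contradiction (trans (≡.sym T-w-w′) removed) λ ()

    nothing-at-w : ∀ (c′ : Vec (Maybe (Fin q)) N) → IsProper G (T ─ ⁅ w ⁆) c′ → lookup c′ w ≡ nothing
    nothing-at-w c′ proper with lookup c′ w | trans (≡.sym removed) (IsProper.support proper w)
    ... | nothing | _  = refl
    ... | just _  | ()

  detach-proper : ∀ c → isProperColouring G T c ≡ true → Detached (detach c) ≡ true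
  detach-proper c proper = ∧-true⁺ (trans (≡.sym (support w)) Tw)
    (IsProper⇒isProperColouring G (T ─ ⁅ w ⁆) (c [ w ]≔ nothing) record { support = support′ ; separates = separates′ })
    where
    open IsProper (isProperColouring⇒IsProper G T c proper)
    support′ : ∀ w′ → lookup (T ─ ⁅ w ⁆) w′ ≡ isJust (lookup (c [ w ]≔ nothing) w′)
    support′ w′ with w′ Fin.≟ w
    ... | yes refl = trans removed (cong isJust (≡.sym (Vec.lookup∘update w c nothing)))
    ... | no  w′≢w = trans (kept w′≢w) (trans (support w′) (cong isJust (≡.sym (Vec.lookup∘update′ w′≢w c nothing))))
    separates′ : ∀ a b → lookup (T ─ ⁅ w ⁆) a ≡ true → lookup (T ─ ⁅ w ⁆) b ≡ true → adj G a b ≡ true →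
                 lookup (c [ w ]≔ nothing) a ≢ lookup (c [ w ]≔ nothing) b
    separates′ a b T-w-a T-w-b ab ca≡cb =
      separates a b (trans (≡.sym (kept a≢w)) T-w-a) (trans (≡.sym (kept b≢w)) T-w-b) ab
        (trans (≡.sym (Vec.lookup∘update′ a≢w c nothing)) (trans ca≡cb (Vec.lookup∘update′ b≢w c nothing)))
      where
      a≢w = ≢w T-w-a
      b≢w = ≢w T-w-b

  attach-proper : ∀ b → Detached b ≡ true → isProperColouring G T (attach b) ≡ true
  attach-proper (m , c′) detached =
    IsProper⇒isProperColouring G T (c′ [ w ]≔ m) record { support = support′ ; separates = separates′ }
    where
    open IsProper (isProperColouring⇒IsProper G (T ─ ⁅ w ⁆) c′ (Bool.∧-conicalʳ (isJust m) _ detached))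
    support′ : ∀ w′ → lookup T w′ ≡ isJust (lookup (c′ [ w ]≔ m) w′)
    support′ w′ with w′ Fin.≟ w
    ... | yes refl = trans Tw (trans (≡.sym (Bool.∧-conicalˡ (isJust m) _ detached))
                                     (cong isJust (≡.sym (Vec.lookup∘update w c′ m))))
    ... | no  w′≢w = trans (≡.sym (kept w′≢w)) (trans (support w′) (cong isJust (≡.sym (Vec.lookup∘update′ w′≢w c′ m))))
    separates′ : ∀ a b → lookup T a ≡ true → lookup T b ≡ true → adj G a b ≡ true →
                 lookup (c′ [ w ]≔ m) a ≢ lookup (c′ [ w ]≔ m) b
    separates′ a b Ta Tb ab ca≡cb with a Fin.≟ w | b Fin.≟ w
    ... | yes refl | _        = contradiction (trans (≡.sym ab) (isolated b Tb)) λ ()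
    ... | no  _    | yes refl = contradiction (trans (≡.sym ab) (trans (Graph.sym G a w) (isolated a Ta))) λ ()
    ... | no  a≢w  | no  b≢w  = separates a b (trans (kept a≢w) Ta) (trans (kept b≢w) Tb) ab
        (trans (≡.sym (Vec.lookup∘update′ a≢w c′ m)) (trans ca≡cb (Vec.lookup∘update′ b≢w c′ m)))

  attach∘detach : ∀ c → attach (detach c) ≡ c
  attach∘detach c = trans (Vec.[]≔-idempotent c w) (Vec.[]≔-lookup c w)

  detach∘attach : ∀ b → Detached b ≡ true → detach (attach b) ≡ b
  detach∘attach (m , c′) detached = cong₂ _,_ (Vec.lookup∘update w c′ m) (begin
    (c′ [ w ]≔ m) [ w ]≔ nothing  ≡⟨ Vec.[]≔-idempotent c′ w ⟩
    c′ [ w ]≔ nothing             ≡⟨ cong (c′ [ w ]≔_) (nothing-at-w c′ proper′) ⟨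
    c′ [ w ]≔ lookup c′ w         ≡⟨ Vec.[]≔-lookup c′ w ⟩
    c′                            ∎)
    where proper′ = isProperColouring⇒IsProper G (T ─ ⁅ w ⁆) c′ (Bool.∧-conicalʳ (isJust m) _ detached)

  numColourings-isolated : numColourings G T q ≡ q * numColourings G (T ─ ⁅ w ⁆) q
  numColourings-isolated = begin
    numColourings G T q
      ≡⟨ countB-bijection (colourings-enumerates q N)
           (pairs-enumerates (colourOptions-enumerates q) (colourings-enumerates q N))
           (isProperColouring G T) Detached detach attach detach-proper attach-proper
           (λ c _ → attach∘detach c) detach∘attach ⟩
    countB Detached (pairs (colourOptions q) (colourings q N))
      ≡⟨ countB≡∑ Detached (pairs (colourOptions q) (colourings q N)) ⟩
    ∑ (pairs (colourOptions q) (colourings q N)) (ind ∘ Detached)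
      ≡⟨ ∑-pairs (colourOptions q) (colourings q N) (ind ∘ Detached) ⟩
    ∑[ m ∈ colourOptions q ] ∑[ c′ ∈ colourings q N ] ind (isJust m ∧ isProperColouring G (T ─ ⁅ w ⁆) c′)
      ≡⟨ ∑-cong (colourOptions q) (λ m → ∑-cong (colourings q N) (λ c′ → ind-∧ (isJust m) _)) ⟩
    ∑[ m ∈ colourOptions q ] ∑[ c′ ∈ colourings q N ] (ind (isJust m) * ind (isProperColouring G (T ─ ⁅ w ⁆) c′))
      ≡⟨ ∑-product (colourOptions q) (colourings q N) (ind ∘ isJust) (ind ∘ isProperColouring G (T ─ ⁅ w ⁆)) ⟩
    ∑ (colourOptions q) (ind ∘ isJust) * ∑ (colourings q N) (ind ∘ isProperColouring G (T ─ ⁅ w ⁆))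
      ≡⟨ cong₂ _*_ (trans (∑-map just (allFin q) (ind ∘ isJust)) (trans (∑-allFin-const q 1) (ℕ.*-identityʳ q)))
                   (≡.sym (countB≡∑ (isProperColouring G (T ─ ⁅ w ⁆)) (colourings q N))) ⟩
    q * numColourings G (T ─ ⁅ w ⁆) q
      ∎

-- The sign of the linear coefficient

∣∣-split : ∀ {k} (S U : Subset k) → (∀ w → lookup U w ≡ true → lookup S w ≡ true) → ∣ U ∣ + ∣ S ─ U ∣ ≡ ∣ S ∣
∣∣-split []       []          U⊆S = refl
∣∣-split (false ∷ S) (false ∷ U) U⊆S = ∣∣-split S U (λ w → U⊆S (suc w))
∣∣-split (true  ∷ S) (false ∷ U) U⊆S = trans (ℕ.+-suc ∣ U ∣ _) (cong suc (∣∣-split S U (λ w → U⊆S (suc w))))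
∣∣-split (s ∷ S) (true  ∷ U) U⊆S with U⊆S zero refl
... | refl = cong suc (∣∣-split S U (λ w → U⊆S (suc w)))

∣∣-positive : ∀ {k} (T : Subset k) w → lookup T w ≡ true → 1 ≤ ∣ T ∣
∣∣-positive (true  ∷ T) zero    _  = s≤s z≤n
∣∣-positive (false ∷ T) (suc w) Tw = ∣∣-positive T w Tw
∣∣-positive (true  ∷ T) (suc w) Tw = ℕ.m≤n⇒m≤1+n (∣∣-positive T w Tw)

∣∣-empty : ∀ {k} (T : Subset k) → (∀ w → lookup T w ≡ false) → ∣ T ∣ ≡ 0
∣∣-empty []      _    = refl
∣∣-empty (t ∷ T) T≡∅ with T≡∅ zero
... | refl = ∣∣-empty T (T≡∅ ∘ suc)

module LinearSign where
  open import Data.Integer using (+_; -_; -[1+_])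
  open import Data.Integer.Tactic.RingSolver using (solve-∀)

  -- linearSign k = (-1)^(k-1), the sign of the linear coefficient of a chromatic polynomial on k vertices.
  linearSign : ℕ → ℤ
  linearSign zero    = -[1+ 0 ]
  linearSign (suc k) = - linearSign k

  linearSign-+ : ∀ a b → linearSign (a + b) ≡ - (linearSign a ℤ.* linearSign b)
  linearSign-+ zero    b = ≡.sym (trans (cong -_ (ℤₚ.-1*i≡-i (linearSign b))) (ℤₚ.neg-involutive (linearSign b)))
  linearSign-+ (suc a) b = trans (cong -_ (linearSign-+ a b)) (negate-left (linearSign a) (linearSign b))
    where
    negate-left : ∀ s t → - (- (s ℤ.* t)) ≡ - ((- s) ℤ.* t)
    negate-left = solve-∀

  ∣linearSign∣ : ∀ k → ℤ.∣ linearSign k ∣ ≡ 1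
  ∣linearSign∣ zero    = refl
  ∣linearSign∣ (suc k) = trans (ℤₚ.∣-i∣≡∣i∣ (linearSign k)) (∣linearSign∣ k)

  ∣linearSign*∣ : ∀ k m → ℤ.∣ linearSign k ℤ.* + m ∣ ≡ m
  ∣linearSign*∣ k m = trans (ℤₚ.abs-* (linearSign k) (+ m)) (trans (cong (_* m) (∣linearSign∣ k)) (ℕ.*-identityˡ m))

  HasLinearSign : ℕ → ℤ → Set
  HasLinearSign k a = a ≡ linearSign k ℤ.* + ℤ.∣ a ∣

  hasLinearSign : ∀ k a m → a ≡ linearSign k ℤ.* + m → HasLinearSign k a
  hasLinearSign k a m a≡ = trans a≡ (cong (λ t → linearSign k ℤ.* + t) (≡.sym (trans (cong ℤ.∣_∣ a≡) (∣linearSign*∣ k m))))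

open LinearSign

module LinearCoefficient (G : Graph) (cp : Subset (n G) → Poly) (hcp : ∀ S → IsChromaticPolynomial G S (cp S)) where

  open import Data.Integer using (+_; -_)
  open import Data.Integer.Tactic.RingSolver using (solve-∀)

  private
    N = n G

  a₁ : Subset N → ℤ
  a₁ T = coeff (cp T) 1

  α : Subset N → ℕ
  α T = chromDisc (cp T)

  Nonempty : Subset N → Set
  Nonempty T = ∃[ w ] lookup T w ≡ true

  a₁-isolated : ∀ T w → lookup T w ≡ true → (∀ w′ → lookup T w′ ≡ true → adj G w w′ ≡ false) →
    a₁ T ≡ + numColourings G (T ─ ⁅ w ⁆) 0
  a₁-isolated T w Tw isolated = begin
    coeff (cp T) 1            ≡⟨ coeff-unique (cp T) (timesX (cp T′)) χ-factor 1 ⟩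
    coeff (cp T′) 0           ≡⟨ coeff₀≡eval₀ (cp T′) ⟩
    eval (cp T′) (+ 0)        ≡⟨ hcp T′ 0 ⟩
    + numColourings G T′ 0    ∎
    where
    T′ = T ─ ⁅ w ⁆
    χ-factor : ∀ q → eval (cp T) (+ q) ≡ eval (timesX (cp T′)) (+ q)
    χ-factor q = begin
      eval (cp T) (+ q)                ≡⟨ hcp T q ⟩
      + numColourings G T q            ≡⟨ cong (λ k → + k) (IsolatedVertex.numColourings-isolated G T w Tw isolated q) ⟩
      + (q * numColourings G T′ q)     ≡⟨ ℤₚ.pos-* q _ ⟩
      + q ℤ.* + numColourings G T′ q   ≡⟨ cong (+ q ℤ.*_) (hcp T′ q) ⟨
      + q ℤ.* eval (cp T′) (+ q)       ≡⟨ eval-timesX (cp T′) (+ q) ⟨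
      eval (timesX (cp T′)) (+ q)      ∎

  sign-isolated : ∀ T w → lookup T w ≡ true → (∀ w′ → lookup T w′ ≡ true → adj G w w′ ≡ false) →
    HasLinearSign ∣ T ∣ (a₁ T)
  sign-isolated T w Tw isolated with Fin.any? (λ w′ → lookup (T ─ ⁅ w ⁆) w′ Bool.≟ true)
  ... | yes (w′ , T′w′) = hasLinearSign ∣ T ∣ (a₁ T) 0 (begin
    a₁ T                             ≡⟨ a₁-isolated T w Tw isolated ⟩
    + numColourings G (T ─ ⁅ w ⁆) 0  ≡⟨ cong (λ k → + k) (numColourings-zero-nonempty G (T ─ ⁅ w ⁆) w′ T′w′) ⟩
    + 0                              ≡⟨ ℤₚ.*-zeroʳ (linearSign ∣ T ∣) ⟨
    linearSign ∣ T ∣ ℤ.* + 0         ∎)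
  ... | no  T′≡∅ = hasLinearSign ∣ T ∣ (a₁ T) 1 (begin
    a₁ T                             ≡⟨ a₁-isolated T w Tw isolated ⟩
    + numColourings G (T ─ ⁅ w ⁆) 0  ≡⟨ cong (λ k → + k) (numColourings-zero-empty G (T ─ ⁅ w ⁆) empty) ⟩
    + 1                              ≡⟨ cong (λ k → linearSign k ℤ.* + 1) ∣T∣≡1 ⟨
    linearSign ∣ T ∣ ℤ.* + 1         ∎)
    where
    empty : ∀ w′ → lookup (T ─ ⁅ w ⁆) w′ ≡ false
    empty w′ = Bool.¬-not λ T′w′ → T′≡∅ (w′ , T′w′)
    ⁅w⁆⊆T : ∀ w′ → lookup ⁅ w ⁆ w′ ≡ true → lookup T w′ ≡ true
    ⁅w⁆⊆T w′ w′∈⁅w⁆ = subst (λ x → lookup T x ≡ true)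
                            (≡.sym (does⇒ (w′ Fin.≟ w) (trans (≡.sym (lookup-⁅⁆ w w′)) w′∈⁅w⁆))) Tw
    ∣T∣≡1 : ∣ T ∣ ≡ 1
    ∣T∣≡1 = begin
      ∣ T ∣                      ≡⟨ ∣∣-split T ⁅ w ⁆ ⁅w⁆⊆T ⟨
      ∣ ⁅ w ⁆ ∣ + ∣ T ─ ⁅ w ⁆ ∣  ≡⟨ cong₂ _+_ (Subset.∣⁅x⁆∣≡1 w) (∣∣-empty (T ─ ⁅ w ⁆) empty) ⟩
      1                          ∎

  a₁-edge : ∀ T u v → lookup T u ≡ true → lookup T v ≡ true → adj G u v ≡ true →
    (∀ U → Nonempty U → ∣ U ∣ < ∣ T ∣ → HasLinearSign ∣ U ∣ (a₁ U)) →
    a₁ T ≡ linearSign ∣ T ∣ ℤ.* + ∑[ U ∈ allSubsets N ] (ind (Separates T u v U) * (α U * α (T ─ U)))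
  a₁-edge T u v Tu Tv uv IH = ℤₚ.neg-injective (begin
    - a₁ T
      ≡⟨ edge-identity ⟨
    ∑ℤ[ U ∈ allSubsets N ] (+ ind (Separates T u v U) ℤ.* (a₁ U ℤ.* a₁ (T ─ U)))
      ≡⟨ ∑ℤ-cong (allSubsets N) term ⟩
    ∑ℤ[ U ∈ allSubsets N ] (- linearSign ∣ T ∣ ℤ.* + f U)
      ≡⟨ ∑ℤ-*ˡ (allSubsets N) (- linearSign ∣ T ∣) (λ U → + f U) ⟩
    - linearSign ∣ T ∣ ℤ.* ∑ℤ[ U ∈ allSubsets N ] (+ f U)
      ≡⟨ cong (ℤ._*_ (- linearSign ∣ T ∣)) (+-∑ (allSubsets N) f) ⟨
    - linearSign ∣ T ∣ ℤ.* + ∑ (allSubsets N) f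
      ≡⟨ ℤₚ.neg-distribˡ-* (linearSign ∣ T ∣) _ ⟨
    - (linearSign ∣ T ∣ ℤ.* + ∑ (allSubsets N) f)
      ∎)
    where
    open EdgeIdentity G cp hcp T u v Tu Tv uv using (edge-identity)
    f : Subset N → ℕ
    f U = ind (Separates T u v U) * (α U * α (T ─ U))
    term : ∀ U → + ind (Separates T u v U) ℤ.* (a₁ U ℤ.* a₁ (T ─ U)) ≡ - linearSign ∣ T ∣ ℤ.* + f U
    term U with Separates T u v U in separates
    ... | false = trans (ℤₚ.*-zeroˡ (a₁ U ℤ.* a₁ (T ─ U))) (≡.sym (ℤₚ.*-zeroʳ (- linearSign ∣ T ∣)))
    ... | true  = begin
      + 1 ℤ.* (a₁ U ℤ.* a₁ D)
        ≡⟨ cong₂ (λ s t → + 1 ℤ.* (s ℤ.* t)) (IH U (u , U-u) ∣U∣<∣T∣) (IH D (v , D-v) ∣D∣<∣T∣) ⟩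
      + 1 ℤ.* ((linearSign ∣ U ∣ ℤ.* + α U) ℤ.* (linearSign ∣ D ∣ ℤ.* + α D))
        ≡⟨ regroup (linearSign ∣ U ∣) (linearSign ∣ D ∣) (+ α U) (+ α D) ⟩
      - (- (linearSign ∣ U ∣ ℤ.* linearSign ∣ D ∣)) ℤ.* (+ α U ℤ.* + α D)
        ≡⟨ cong₂ (λ s t → - s ℤ.* t) (trans (≡.sym (linearSign-+ ∣ U ∣ ∣ D ∣)) (cong linearSign ∣U∣+∣D∣))
                                      (≡.sym (ℤₚ.pos-* (α U) (α D))) ⟩
      - linearSign ∣ T ∣ ℤ.* + (α U * α D)
        ≡⟨ cong (λ t → - linearSign ∣ T ∣ ℤ.* + t) (ℕ.*-identityˡ (α U * α D)) ⟨
      - linearSign ∣ T ∣ ℤ.* + (1 * (α U * α D))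
        ∎
      where
      D = T ─ U
      U⊆T = ⊆ᵇ⁻ {U = U} {T} (Bool.∧-conicalˡ (U ⊆ᵇ T) _ separates)
      U-u : lookup U u ≡ true
      U-u = Bool.∧-conicalˡ (lookup U u) _ (Bool.∧-conicalʳ (U ⊆ᵇ T) _ separates)
      D-v : lookup D v ≡ true
      D-v = trans (lookup-─ T U v) (cong₂ _∧_ Tv (Bool.∧-conicalʳ (lookup U u) _ (Bool.∧-conicalʳ (U ⊆ᵇ T) _ separates)))
      ∣U∣+∣D∣ : ∣ U ∣ + ∣ D ∣ ≡ ∣ T ∣
      ∣U∣+∣D∣ = ∣∣-split T U U⊆T
      ∣U∣<∣T∣ : ∣ U ∣ < ∣ T ∣
      ∣U∣<∣T∣ = subst (∣ U ∣ <_) ∣U∣+∣D∣ (ℕ.m<m+n ∣ U ∣ (∣∣-positive D v D-v))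
      ∣D∣<∣T∣ : ∣ D ∣ < ∣ T ∣
      ∣D∣<∣T∣ = subst (∣ D ∣ <_) ∣U∣+∣D∣ (ℕ.m<n+m ∣ D ∣ (∣∣-positive U u U-u))
      regroup : ∀ s t a b → + 1 ℤ.* ((s ℤ.* a) ℤ.* (t ℤ.* b)) ≡ - (- (s ℤ.* t)) ℤ.* (a ℤ.* b)
      regroup = solve-∀

  a₁-sign : ∀ T → Nonempty T → HasLinearSign ∣ T ∣ (a₁ T)
  a₁-sign T = <-rec P step ∣ T ∣ T refl
    where
    P : ℕ → Set
    P k = ∀ T → ∣ T ∣ ≡ k → Nonempty T → HasLinearSign ∣ T ∣ (a₁ T)
    step : ∀ k → (∀ {j} → j < k → P j) → P k
    step k IH T refl (w , Tw)
      with Fin.any? (λ a → Fin.any? (λ b → (lookup T a ∧ (lookup T b ∧ adj G a b)) Bool.≟ true))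
    ... | yes (a , b , edge) = hasLinearSign ∣ T ∣ (a₁ T) _
            (a₁-edge T a b (Bool.∧-conicalˡ _ _ edge) (Bool.∧-conicalˡ _ _ (Bool.∧-conicalʳ (lookup T a) _ edge))
                     (Bool.∧-conicalʳ (lookup T b) _ (Bool.∧-conicalʳ (lookup T a) _ edge))
                     (λ U nonempty ∣U∣<∣T∣ → IH ∣U∣<∣T∣ U refl nonempty))
    ... | no  no-edge = sign-isolated T w Tw λ w′ Tw′ →
            Bool.¬-not λ ww′ → no-edge (w , w′ , ∧-true⁺ Tw (∧-true⁺ Tw′ ww′))

  α-edge : ∀ T u v → lookup T u ≡ true → lookup T v ≡ true → adj G u v ≡ true →
    α T ≡ ∑[ U ∈ allSubsets N ] (ind (Separates T u v U) * (α U * α (T ─ U)))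
  α-edge T u v Tu Tv uv =
    trans (cong ℤ.∣_∣ (a₁-edge T u v Tu Tv uv (λ U nonempty _ → a₁-sign U nonempty))) (∣linearSign*∣ ∣ T ∣ _)

-- Double counting over the edges

module _ (G : Graph) where
  open import Data.Nat.Tactic.RingSolver using (solve-∀)

  private
    N = n G
    vertices = allFin N

    <ᵇ-true : ∀ {m k} → m < k → (m <ᵇ k) ≡ true
    <ᵇ-true m<k = Equivalence.to Bool.T-≡ (ℕ.<⇒<ᵇ m<k)

    <ᵇ-false : ∀ {m k} → ¬ m < k → (m <ᵇ k) ≡ false
    <ᵇ-false {m} {k} m≮k = Bool.¬-not λ m<ᵇk → m≮k (ℕ.<ᵇ⇒< m k (Equivalence.from Bool.T-≡ m<ᵇk))

  IncreasingEdge : Fin N → Fin N → Bool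
  IncreasingEdge a b = (toℕ a <ᵇ toℕ b) ∧ adj G a b

  adj-split : ∀ a b → ind (adj G a b) ≡ ind (IncreasingEdge a b) + ind (IncreasingEdge b a)
  adj-split a b with ℕ.<-cmp (toℕ a) (toℕ b)
  ... | tri< a<b _ b≮a rewrite <ᵇ-true a<b | <ᵇ-false b≮a = ≡.sym (ℕ.+-identityʳ _)
  ... | tri> a≮b _ b<a rewrite <ᵇ-false a≮b | <ᵇ-true b<a = cong ind (Graph.sym G a b)
  ... | tri≈ _ a≡b _ rewrite Fin.toℕ-injective a≡b | Graph.irrefl G b | Bool.∧-zeroʳ (toℕ b <ᵇ toℕ b) = refl

  twice-numEdges : 2 * numEdges G ≡ ∑[ a ∈ vertices ] ∑[ b ∈ vertices ] ind (adj G a b)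
  twice-numEdges = ≡.sym (begin
    ∑[ a ∈ vertices ] ∑[ b ∈ vertices ] ind (adj G a b)
      ≡⟨ ∑-cong vertices (λ a → trans (∑-cong vertices (adj-split a)) (∑-distrib-+ vertices _ _)) ⟩
    ∑[ a ∈ vertices ] (∑[ b ∈ vertices ] ind (IncreasingEdge a b) + ∑[ b ∈ vertices ] ind (IncreasingEdge b a))
      ≡⟨ ∑-distrib-+ vertices _ _ ⟩
    E + ∑[ a ∈ vertices ] ∑[ b ∈ vertices ] ind (IncreasingEdge b a)
      ≡⟨ cong (E +_) (∑-comm vertices vertices (λ a b → ind (IncreasingEdge b a))) ⟩
    E + E
      ≡⟨ cong (E +_) (ℕ.+-identityʳ E) ⟨
    2 * E
      ≡⟨ cong (2 *_) numEdges≡∑ ⟨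
    2 * numEdges G
      ∎)
    where
    E = ∑[ a ∈ vertices ] ∑[ b ∈ vertices ] ind (IncreasingEdge a b)
    numEdges≡∑ : numEdges G ≡ E
    numEdges≡∑ = trans (countB≡∑ (λ ab → IncreasingEdge (proj₁ ab) (proj₂ ab)) (pairs vertices vertices))
                       (∑-pairs vertices vertices (λ ab → ind (IncreasingEdge (proj₁ ab) (proj₂ ab))))

  numStraddling≡∑ : ∀ U → numStraddling G U ≡ ∑[ a ∈ vertices ] ∑[ b ∈ vertices ] ind (lookup U a ∧ not (lookup U b) ∧ adj G a b)
  numStraddling≡∑ U = trans (sum-map vertices _) (∑-cong vertices (λ a → countB≡∑ _ vertices))

  nonemptyB⁺ : ∀ {k} (U : Subset k) a → lookup U a ≡ true → nonemptyB U ≡ true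
  nonemptyB⁺ {k} U a Ua = cong not (Bool.¬-not λ none →
    contradiction (trans (≡.sym (cong not Ua)) (allB-allFin⁻ (λ v → not (lookup U v)) none a)) λ ())

  numStraddling-unbalanced : ∀ U → nonemptyB U ∧ nonemptyB (∁ U) ≡ false → numStraddling G U ≡ 0
  numStraddling-unbalanced U unbalanced =
    trans (numStraddling≡∑ U) (∑-zero vertices _ λ a → ∑-zero vertices _ λ b → cong ind (Bool.¬-not λ straddles →
      let Ua   = Bool.∧-conicalˡ (lookup U a) _ straddles
          ∁U-b = trans (Vec.lookup-map b not U) (Bool.∧-conicalˡ _ _ (Bool.∧-conicalʳ (lookup U a) _ straddles))
      in contradiction (trans (≡.sym unbalanced) (∧-true⁺ (nonemptyB⁺ U a Ua) (nonemptyB⁺ (∁ U) b ∁U-b))) λ ()))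

  module _ (cp : Subset N → Poly) (hcp : ∀ S → IsChromaticPolynomial G S (cp S)) where
    open LinearCoefficient G cp hcp using (α; α-edge)

    partitionSum≡∑ : partitionSum G cp ≡ ∑[ U ∈ allSubsets N ] (α U * α (∁ U) * numStraddling G U)
    partitionSum≡∑ = trans (sum-map (allSubsets N) _) (∑-cong (allSubsets N) guard)
      where
      guard : ∀ U → (if nonemptyB U ∧ nonemptyB (∁ U) then α U * α (∁ U) * numStraddling G U else 0)
                    ≡ α U * α (∁ U) * numStraddling G U
      guard U with nonemptyB U ∧ nonemptyB (∁ U) in balanced
      ... | true  = refl
      ... | false = ≡.sym (trans (cong (α U * α (∁ U) *_) (numStraddling-unbalanced U balanced)) (ℕ.*-zeroʳ (α U * α (∁ U))))

    α⊤-edge : ∀ a b → adj G a b ≡ true →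
      α ⊤ ≡ ∑[ U ∈ allSubsets N ] (ind (lookup U a ∧ not (lookup U b)) * (α U * α (∁ U)))
    α⊤-edge a b ab = trans (α-edge ⊤ a b (Vec.lookup-replicate a true) (Vec.lookup-replicate b true) ab)
      (∑-cong (allSubsets N) λ U → cong₂ (λ s t → ind s * (α U * α t)) (cong (_∧ (lookup U a ∧ not (lookup U b))) (U⊆⊤ U)) (⊤─U≡∁U U))
      where
      U⊆⊤ : ∀ U → U ⊆ᵇ ⊤ ≡ true
      U⊆⊤ U = allB⁺ vertices _ λ w → trans (cong (not (lookup U w) ∨_) (Vec.lookup-replicate w true)) (Bool.∨-zeroʳ _)
      ⊤─U≡∁U : ∀ U → ⊤ ─ U ≡ ∁ U
      ⊤─U≡∁U U = lookup-≗⇒≡ λ w → trans (lookup-─ ⊤ U w)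
        (trans (cong (_∧ not (lookup U w)) (Vec.lookup-replicate w true)) (≡.sym (Vec.lookup-map w not U)))

    adjacent-pairs-double-count : ∑[ a ∈ vertices ] ∑[ b ∈ vertices ] (ind (adj G a b) * α ⊤)
                 ≡ ∑[ U ∈ allSubsets N ] (α U * α (∁ U) * numStraddling G U)
    adjacent-pairs-double-count = begin
      ∑[ a ∈ vertices ] ∑[ b ∈ vertices ] (ind (adj G a b) * α ⊤)
        ≡⟨ ∑-cong vertices (λ a → ∑-cong vertices (λ b → ind-*-cong (adj G a b) (α⊤-edge a b))) ⟩
      ∑[ a ∈ vertices ] ∑[ b ∈ vertices ] (ind (adj G a b) * ∑[ U ∈ allSubsets N ] (ind (S U a b) * K U))
        ≡⟨ ∑-cong vertices (λ a → ∑-cong vertices (λ b → ∑-*ˡ (allSubsets N) (ind (adj G a b)) _)) ⟨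
      ∑[ a ∈ vertices ] ∑[ b ∈ vertices ] ∑[ U ∈ allSubsets N ] (ind (adj G a b) * (ind (S U a b) * K U))
        ≡⟨ ∑-cong vertices (λ a → ∑-comm vertices (allSubsets N) _) ⟩
      ∑[ a ∈ vertices ] ∑[ U ∈ allSubsets N ] ∑[ b ∈ vertices ] (ind (adj G a b) * (ind (S U a b) * K U))
        ≡⟨ ∑-comm vertices (allSubsets N) _ ⟩
      ∑[ U ∈ allSubsets N ] ∑[ a ∈ vertices ] ∑[ b ∈ vertices ] (ind (adj G a b) * (ind (S U a b) * K U))
        ≡⟨ ∑-cong (allSubsets N) (λ U → ∑-cong vertices (λ a → ∑-cong vertices (λ b → regroup U a b))) ⟩
      ∑[ U ∈ allSubsets N ] ∑[ a ∈ vertices ] ∑[ b ∈ vertices ] (K U * ind (lookup U a ∧ not (lookup U b) ∧ adj G a b))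
        ≡⟨ ∑-cong (allSubsets N) (λ U → trans (∑-cong vertices (λ a → ∑-*ˡ vertices (K U) _)) (∑-*ˡ vertices (K U) _)) ⟩
      ∑[ U ∈ allSubsets N ] (K U * ∑[ a ∈ vertices ] ∑[ b ∈ vertices ] ind (lookup U a ∧ not (lookup U b) ∧ adj G a b))
        ≡⟨ ∑-cong (allSubsets N) (λ U → cong (K U *_) (numStraddling≡∑ U)) ⟨
      ∑[ U ∈ allSubsets N ] (α U * α (∁ U) * numStraddling G U)
        ∎
      where
      S : Subset N → Fin N → Fin N → Bool
      S U a b = lookup U a ∧ not (lookup U b)
      K : Subset N → ℕ
      K U = α U * α (∁ U)
      ind-*-cong : ∀ t {x y} → (t ≡ true → x ≡ y) → ind t * x ≡ ind t * y
      ind-*-cong true  x≡y = cong (1 *_) (x≡y refl)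
      ind-*-cong false _   = refl
      regroup : ∀ U a b → ind (adj G a b) * (ind (S U a b) * K U) ≡ K U * ind (lookup U a ∧ not (lookup U b) ∧ adj G a b)
      regroup U a b = begin
        ind (adj G a b) * (ind (S U a b) * K U)
          ≡⟨ cong (λ t → ind (adj G a b) * (t * K U)) (ind-∧ (lookup U a) _) ⟩
        ind (adj G a b) * (ind (lookup U a) * ind (not (lookup U b)) * K U)
          ≡⟨ commute (ind (adj G a b)) (ind (lookup U a)) (ind (not (lookup U b))) (K U) ⟩
        K U * (ind (lookup U a) * (ind (not (lookup U b)) * ind (adj G a b)))
          ≡⟨ cong (λ t → K U * (ind (lookup U a) * t)) (ind-∧ (not (lookup U b)) _) ⟨
        K U * (ind (lookup U a) * ind (not (lookup U b) ∧ adj G a b))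
          ≡⟨ cong (K U *_) (ind-∧ (lookup U a) _) ⟨
        K U * ind (lookup U a ∧ not (lookup U b) ∧ adj G a b)
          ∎
        where
        commute : ∀ c x y k → c * (x * y * k) ≡ k * (x * (y * c))
        commute = solve-∀

mainTheorem1 : (G : Graph) (cp : Subset (n G) → Poly)
    → (∀ S → IsChromaticPolynomial G S (cp S))
    → 2 * numEdges G * chromDisc (cp ⊤) ≡ partitionSum G cp
mainTheorem1 G cp hcp = begin
  2 * numEdges G * α⊤
    ≡⟨ cong (_* α⊤) (twice-numEdges G) ⟩
  (∑[ a ∈ allFin (n G) ] ∑[ b ∈ allFin (n G) ] ind (adj G a b)) * α⊤
    ≡⟨ ∑-*ʳ (allFin (n G)) α⊤ _ ⟨
  ∑[ a ∈ allFin (n G) ] (∑[ b ∈ allFin (n G) ] ind (adj G a b) * α⊤)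
    ≡⟨ ∑-cong (allFin (n G)) (λ a → ∑-*ʳ (allFin (n G)) α⊤ (ind ∘ adj G a)) ⟨
  ∑[ a ∈ allFin (n G) ] ∑[ b ∈ allFin (n G) ] (ind (adj G a b) * α⊤)
    ≡⟨ adjacent-pairs-double-count G cp hcp ⟩
  ∑[ U ∈ allSubsets (n G) ] (chromDisc (cp U) * chromDisc (cp (∁ U)) * numStraddling G U)
    ≡⟨ partitionSum≡∑ G cp hcp ⟨
  partitionSum G cp
    ∎
  where
  α⊤ = chromDisc (cp ⊤)
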